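{- Let $q=2$, $G=\mathrm{SL}_2(\mathbb{F}_2)$, $k\ge0$, and $d_{k,2}=\dim_{\mathbb{F}_2}\mathrm{Hom}_{\mathbb{F}_2[G]}(\overline{\mathrm{st}},\overline{L}_k)$. Then $\dim\overline{L}_k\equiv\pm1\pmod 3$ and $$d_{k,2}=\left\lfloor\frac{\dim\overline{L}_k+1}{3}\right\rfloor.$$
   Context: For $k\ge0$, $\overline{L}_k$ is the $\mathbb{F}_q$-span of the monomials $X^iY^{k-i}$ with $\binom{k}{i}\not\equiv0\pmod p$ inside the homogeneous degree-$k$ polynomials in $\mathbb{F}_q[X,Y]$, with $\mathrm{SL}_2(\mathbb{F}_q)$ acting by $\begin{pmatrix}a&b\\c&d\end{pmatrix}\cdot X^iY^j=(aX+cY)^i(bX+dY)^j$; $\overline{\mathrm{st}}:=\overline{L}_{q-1}$ is the Steinberg module. $d_{k,q}$ equals the dimension of the space of $\mathrm{SL}_2(\mathbb{F}_q[t])$-invariant harmonic cocycles with values in $L_k$. -}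

module Defs where

open import Data.Bool using (Bool; true; false; _∧_; _xor_)
open import Data.Nat using (ℕ; zero; suc; _+_; _∸_; _%_)
open import Data.Nat.Combinatorics using (_C_)
open import Data.Fin using (Fin; toℕ) renaming (zero to fzero; suc to fsuc)
open import Data.Vec using (Vec; []; _∷_; lookup; tabulate; zipWith; map; replicate)
open import Data.Product using (Σ; _×_; _,_)
open import Relation.Binary.PropositionalEquality using (_≡_)

-- The field F_2 is Bool with xor as addition and ∧ as multiplication.

⊕< : ℕ → (ℕ → Bool) → Bool
⊕< zero    f = false
⊕< (suc n) f = ⊕< n f xor f n

-- Homogeneous polynomials of degree k in F_2[X,Y].
-- An element of Poly k is the coefficient vector indexed by the
-- X-exponent i ∈ {0..k}: entry i is the coefficient of X^i Y^(k-i).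

Poly : ℕ → Set
Poly k = Vec Bool (suc k)

-- Coefficient functions (finite support) used to compute products:
-- a homogeneous polynomial is encoded by f : ℕ → Bool, f i = coefficient
-- of X^i Y^(deg - i).  Multiplication of homogeneous polynomials is
-- convolution in the X-exponent.
conv : (ℕ → Bool) → (ℕ → Bool) → ℕ → Bool
conv f g m = ⊕< (suc m) (λ i → f i ∧ g (m ∸ i))

one : ℕ → Bool
one zero    = true
one (suc _) = false

linForm : Bool → Bool → ℕ → Bool
linForm a c zero          = c
linForm a c (suc zero)    = a
linForm a c (suc (suc _)) = false

pow : (ℕ → Bool) → ℕ → ℕ → Bool
pow f zero    = one
pow f (suc i) = conv f (pow f i)

-- SL_2(F_2): matrices (a b; c d) with ad - bc = ad + bc = 1.

record Mat : Set where
  constructor mat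
  field
    a b c d : Bool

open Mat public

InSL2 : Mat → Set
InSL2 g = ((a g ∧ d g) xor (b g ∧ c g)) ≡ true

-- Action on Poly k:  g · X^i Y^j = (aX + cY)^i (bX + dY)^j, extended linearly.
act : (k : ℕ) → Mat → Poly k → Poly k
act k g p = tabulate λ m →
  ⊕< (suc k) (λ i → coeff i ∧
     conv (pow (linForm (a g) (c g)) i) (pow (linForm (b g) (d g)) (k ∸ i)) (toℕ m))
  where
  coeff : ℕ → Bool
  coeff i = lookupℕ p i
    where
    lookupℕ : ∀ {n} → Vec Bool n → ℕ → Bool
    lookupℕ [] _ = false
    lookupℕ (x ∷ xs) zero = x
    lookupℕ (x ∷ xs) (suc j) = lookupℕ xs j

_+P_ : ∀ {k} → Poly k → Poly k → Poly k
_+P_ = zipWith _xor_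

_·P_ : ∀ {k} → Bool → Poly k → Poly k
s ·P p = map (s ∧_) p

0P : ∀ {k} → Poly k
0P = replicate _ false

-- \bar L_k : span of the monomials X^i Y^(k-i) with binom(k,i) odd,
-- i.e. the polynomials whose coefficients vanish where binom(k,i) is even.

InL : (k : ℕ) → Poly k → Set
InL k p = (i : Fin (suc k)) → (k C toℕ i) % 2 ≡ 0 → lookup p i ≡ false

-- Steinberg module for q = 2:  \bar st = \bar L_{q-1} = \bar L_1.
InSt : Poly 1 → Set
InSt = InL 1

lincomb : {V : Set} → (V → V → V) → (Bool → V → V) → V →
          (n : ℕ) → (Fin n → Bool) → (Fin n → V) → V
lincomb _+_ _·_ z zero    λs bs = z
lincomb _+_ _·_ z (suc n) λs bs =
  (λs fzero · bs fzero) + lincomb _+_ _·_ z n (λ j → λs (fsuc j)) (λ j → bs (fsuc j))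

HasDim : (V : Set) (_≈_ : V → V → Set) (_+_ : V → V → V) (_·_ : Bool → V → V)
         (z : V) (S : V → Set) (n : ℕ) → Set
HasDim V _≈_ _+_ _·_ z S n =
  Σ (Fin n → V) λ bs →
    ((j : Fin n) → S (bs j))
    × ((λs : Fin n → Bool) → lincomb _+_ _·_ z n λs bs ≈ z → (j : Fin n) → λs j ≡ false)
    × ((v : V) → S v → Σ (Fin n → Bool) λ λs → v ≈ lincomb _+_ _·_ z n λs bs)

DimL : (k n : ℕ) → Set
DimL k n = HasDim (Poly k) _≡_ _+P_ _·P_ 0P (InL k) n

-- Hom_{F_2[G]}(\bar st, \bar L_k), G = SL_2(F_2).
-- Maps are represented by functions Poly 1 → Poly k; only their values on
-- \bar st matter (equality is equality on \bar st).

Map : ℕ → Set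
Map k = Poly 1 → Poly k

IsGHom : (k : ℕ) → Map k → Set
IsGHom k f =
    ((u : Poly 1) → InSt u → InL k (f u))
  × ((u v : Poly 1) → InSt u → InSt v → f (u +P v) ≡ (f u +P f v))
  × ((s : Bool) (u : Poly 1) → InSt u → f (s ·P u) ≡ (s ·P f u))
  × ((g : Mat) → InSL2 g → (u : Poly 1) → InSt u → f (act 1 g u) ≡ act k g (f u))

_≈M_ : ∀ {k} → Map k → Map k → Set
f ≈M f' = (u : Poly 1) → InSt u → f u ≡ f' u

_+M_ : ∀ {k} → Map k → Map k → Map k
(f +M f') u = f u +P f' u

_·M_ : ∀ {k} → Bool → Map k → Map k
(s ·M f) u = s ·P f u

0M : ∀ {k} → Map k
0M u = 0P

DimHom : (k n : ℕ) → Set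
DimHom k n = HasDim (Map k) _≈M_ _+M_ _·M_ 0M (IsGHom k) n

-- G = SL₂(F₂) ≅ S₃ is generated by S (swapping X and Y), T (fixing X, sending Y to X + Y)
-- and R (X ↦ X + Y ↦ Y ↦ X).  By Lucas' theorem and Steinberg's tensor product theorem
-- (Frobenius twists are trivial over F₂), L̄_k ≅ st^⊗s where s is the number of ones in the
-- binary expansion of k, so dim L̄_k = 2^s.
--
-- A G-map f : st → M is determined by w = f(X), subject to T w = w and w + S w + R w = 0;
-- call W(M) the space of such w, and M^R the vectors fixed by R.  Writing st^⊗(s+1) as
-- st^⊗s ⊗ Y ⊕ st^⊗s ⊗ X, explicit maps give W(st^⊗(s+1)) ≅ (st^⊗s)^R ⊕ W(st^⊗s) and
-- (st^⊗(s+1))^R ≅ W(st^⊗s)², so w_s = dim W(st^⊗s) and m_s = dim (st^⊗s)^R satisfy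
-- w₀ = 0, m₀ = 1, w_(s+1) = m_s + w_s, m_(s+1) = 2 w_s.  Hence 2^s = 2 w_s + m_s and
-- m_s − w_s = ±1, that is 2^s ≡ ±1 (mod 3) and w_s = ⌊(2^s + 1)/3⌋.

module Submission where

open import Defs
open import Algebra.Bundles using (CommutativeRing)
open import Data.Bool using (Bool; true; false; _∧_; _xor_; not; if_then_else_)
open import Data.Bool.Properties
  using (_≟_; xor-comm; xor-assoc; xor-identityˡ; xor-identityʳ; xor-same; not-involutive;
         not-distribˡ-xor; ∧-comm; ∧-assoc; ∧-zeroʳ; ∧-identityʳ; ∧-idem; ∧-distribˡ-xor;
         ∧-distribʳ-xor; xor-∧-commutativeRing)
open import Algebra.Properties.CommutativeSemigroup
  (CommutativeRing.+-commutativeSemigroup xor-∧-commutativeRing) using (interchange)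
open import Data.Fin using (Fin; toℕ; fromℕ<) renaming (zero to fzero; suc to fsuc)
open import Data.Fin.Properties using (toℕ-fromℕ<)
open import Data.List using (List; []; _∷_; [_]; _++_; map; filterᵇ; foldr; concatMap; cartesianProductWith)
open import Data.List.Relation.Unary.All using (All; []; _∷_)
open import Data.List.Relation.Unary.All.Properties using (++⁺)
open import Data.Nat using (ℕ; zero; suc; _+_; _*_; _∸_; _%_; _/_; _<_; _≤_; z≤n; s≤s; _<?_)
open import Data.Nat.Combinatorics using (_C_; nCk+nC[k+1]≡[n+1]C[k+1])
open import Data.Nat.DivMod
  using ([m+n]%n≡m%n; [m+kn]%n≡m%n; +-distrib-/; m<n⇒m%n≡m; m*n%n≡0; m<n⇒m/n≡0; m*n/n≡m)
open import Data.Nat.Properties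
  using (+-suc; +-comm; +-identityʳ; n∸n≡0; ∸-+-assoc; +-∸-assoc; m+n∸m≡n; m+[n∸m]≡n;
         m∸[m∸n]≡n; m<n⇒m<1+n; n<1+n; m<1+n⇒m≤n; +-mono-≤; m≤n⇒m≤1+n; ≰⇒>; ≤-pred)
open import Data.Nat.Tactic.RingSolver using (solve-∀)
open import Data.Product using (Σ; _×_; _,_; proj₁; proj₂)
open import Data.Sum using (_⊎_; inj₁; inj₂)
open import Data.Unit using (⊤; tt)
open import Data.Vec using (Vec; []; _∷_; lookup; tabulate; zipWith; replicate; take; drop)
  renaming (_++_ to _++ᵛ_)
open import Data.Vec.Properties
  using (tabulate-cong; tabulate-∘; lookup∘tabulate; tabulate∘lookup; lookup-zipWith; lookup-replicate;
         map-id; map-const; zipWith-identityˡ; zipWith-inverseʳ; take-zipWith; drop-zipWith;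
         take++drop≡id; ++-injective)
open import Relation.Nullary using (does; yes; no)
open import Relation.Binary.PropositionalEquality
  using (_≡_; refl; sym; trans; cong; cong₂; subst; _≗_; module ≡-Reasoning)

xor-interchange : ∀ w x y z → (w xor x) xor (y xor z) ≡ (w xor y) xor (x xor z)
xor-interchange = interchange

⊕<-cong : ∀ n {f g : ℕ → Bool} → (∀ i → i < n → f i ≡ g i) → ⊕< n f ≡ ⊕< n g
⊕<-cong zero    f≡g = refl
⊕<-cong (suc n) f≡g =
  cong₂ _xor_ (⊕<-cong n (λ i i<n → f≡g i (m<n⇒m<1+n i<n))) (f≡g n (n<1+n n))

⊕<-false : ∀ n → ⊕< n (λ _ → false) ≡ false
⊕<-false zero    = refl
⊕<-false (suc n) = trans (xor-identityʳ _) (⊕<-false n)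

⊕<-vanishes : ∀ n {f : ℕ → Bool} → (∀ i → i < n → f i ≡ false) → ⊕< n f ≡ false
⊕<-vanishes n f≡0 = trans (⊕<-cong n f≡0) (⊕<-false n)

⊕<-xor : ∀ n f g → ⊕< n (λ i → f i xor g i) ≡ ⊕< n f xor ⊕< n g
⊕<-xor zero    f g = refl
⊕<-xor (suc n) f g =
  trans (cong (_xor (f n xor g n)) (⊕<-xor n f g)) (xor-interchange (⊕< n f) (⊕< n g) (f n) (g n))

⊕<-∧ˡ : ∀ n b f → ⊕< n (λ i → b ∧ f i) ≡ b ∧ ⊕< n f
⊕<-∧ˡ zero    b f = sym (∧-zeroʳ b)
⊕<-∧ˡ (suc n) b f =
  trans (cong (_xor (b ∧ f n)) (⊕<-∧ˡ n b f)) (sym (∧-distribˡ-xor b (⊕< n f) (f n)))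

⊕<-∧ʳ : ∀ n b f → ⊕< n (λ i → f i ∧ b) ≡ ⊕< n f ∧ b
⊕<-∧ʳ n b f =
  trans (⊕<-cong n (λ i _ → ∧-comm (f i) b)) (trans (⊕<-∧ˡ n b f) (∧-comm b _))

⊕<-head : ∀ n f → ⊕< (suc n) f ≡ f 0 xor ⊕< n (λ i → f (suc i))
⊕<-head zero    f = xor-comm false (f 0)
⊕<-head (suc n) f = trans (cong (_xor f (suc n)) (⊕<-head n f)) (xor-assoc (f 0) _ _)

⊕<-reverse : ∀ n f → ⊕< n f ≡ ⊕< n (λ i → f (n ∸ suc i))
⊕<-reverse zero    f = refl
⊕<-reverse (suc n) f =
  trans (cong (_xor f n) (⊕<-reverse n f))
        (trans (xor-comm _ (f n)) (sym (⊕<-head n (λ i → f (n ∸ i)))))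

⊕<-comm : ∀ m n (F : ℕ → ℕ → Bool) →
          ⊕< m (λ i → ⊕< n (F i)) ≡ ⊕< n (λ j → ⊕< m (λ i → F i j))
⊕<-comm zero    n F = sym (⊕<-false n)
⊕<-comm (suc m) n F =
  trans (cong (_xor ⊕< n (F m)) (⊕<-comm m n F))
        (sym (⊕<-xor n (λ j → ⊕< m (λ i → F i j)) (F m)))

⊕<-triangle : ∀ N (F : ℕ → ℕ → Bool) →
  ⊕< N (λ m → ⊕< (suc m) (λ i → F i m)) ≡ ⊕< N (λ i → ⊕< (N ∸ i) (λ j → F i (i + j)))
⊕<-triangle zero    F = refl
⊕<-triangle (suc N) F = begin
  ⊕< N (λ m → ⊕< (suc m) (λ i → F i m)) xor lastColumn
    ≡⟨ cong (_xor lastColumn) (⊕<-triangle N F) ⟩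
  ⊕< N rows xor lastColumn
    ≡⟨ cong (_xor lastColumn) (sym (trans (cong (⊕< N rows xor_) rowN-empty) (xor-identityʳ (⊕< N rows)))) ⟩
  ⊕< (suc N) rows xor lastColumn
    ≡⟨ sym (⊕<-xor (suc N) rows (λ i → F i N)) ⟩
  ⊕< (suc N) (λ i → rows i xor F i N)
    ≡⟨ ⊕<-cong (suc N) extendRow ⟩
  ⊕< (suc N) (λ i → ⊕< (suc N ∸ i) (λ j → F i (i + j))) ∎
  where
  open ≡-Reasoning
  rows : ℕ → Bool
  rows i = ⊕< (N ∸ i) (λ j → F i (i + j))
  lastColumn : Bool
  lastColumn = ⊕< (suc N) (λ i → F i N)
  rowN-empty : rows N ≡ false
  rowN-empty = cong (λ n → ⊕< n (λ j → F N (N + j))) (n∸n≡0 N)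
  extendRow : ∀ i → i < suc N → rows i xor F i N ≡ ⊕< (suc N ∸ i) (λ j → F i (i + j))
  extendRow i i<1+N = begin
    rows i xor F i N                         ≡⟨ cong (λ m → rows i xor F i m) (sym (m+[n∸m]≡n i≤N)) ⟩
    ⊕< (suc (N ∸ i)) (λ j → F i (i + j))     ≡⟨ cong (λ n → ⊕< n (λ j → F i (i + j))) (sym (+-∸-assoc 1 i≤N)) ⟩
    ⊕< (suc N ∸ i) (λ j → F i (i + j))       ∎
    where i≤N = m<1+n⇒m≤n i<1+N

Seq : Set
Seq = ℕ → Bool

conv-cong : ∀ {f f′ g g′} → f ≗ f′ → g ≗ g′ → conv f g ≗ conv f′ g′
conv-cong f≗f′ g≗g′ m = ⊕<-cong (suc m) (λ i _ → cong₂ _∧_ (f≗f′ i) (g≗g′ (m ∸ i)))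

conv-comm : ∀ f g → conv f g ≗ conv g f
conv-comm f g m = trans (⊕<-reverse (suc m) (λ i → f i ∧ g (m ∸ i))) (⊕<-cong (suc m) swap)
  where
  swap : ∀ i → i < suc m → f (m ∸ i) ∧ g (m ∸ (m ∸ i)) ≡ g i ∧ f (m ∸ i)
  swap i i<1+m = trans (cong (λ j → f (m ∸ i) ∧ g j) (m∸[m∸n]≡n (m<1+n⇒m≤n i<1+m))) (∧-comm (f (m ∸ i)) (g i))

conv-assoc : ∀ f g h → conv (conv f g) h ≗ conv f (conv g h)
conv-assoc f g h m = begin
  ⊕< (suc m) (λ n → conv f g n ∧ h (m ∸ n))
    ≡⟨ ⊕<-cong (suc m) (λ n _ → sym (⊕<-∧ʳ (suc n) (h (m ∸ n)) (λ i → f i ∧ g (n ∸ i)))) ⟩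
  ⊕< (suc m) (λ n → ⊕< (suc n) (λ i → (f i ∧ g (n ∸ i)) ∧ h (m ∸ n)))
    ≡⟨ ⊕<-triangle (suc m) (λ i n → (f i ∧ g (n ∸ i)) ∧ h (m ∸ n)) ⟩
  ⊕< (suc m) (λ i → ⊕< (suc m ∸ i) (λ j → (f i ∧ g (i + j ∸ i)) ∧ h (m ∸ (i + j))))
    ≡⟨ ⊕<-cong (suc m) row ⟩
  ⊕< (suc m) (λ i → f i ∧ conv g h (m ∸ i)) ∎
  where
  open ≡-Reasoning
  row : ∀ i → i < suc m →
        ⊕< (suc m ∸ i) (λ j → (f i ∧ g (i + j ∸ i)) ∧ h (m ∸ (i + j))) ≡ f i ∧ conv g h (m ∸ i)
  row i i<1+m = begin
    ⊕< (suc m ∸ i) (λ j → (f i ∧ g (i + j ∸ i)) ∧ h (m ∸ (i + j)))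
      ≡⟨ cong (λ n → ⊕< n (λ j → (f i ∧ g (i + j ∸ i)) ∧ h (m ∸ (i + j)))) (+-∸-assoc 1 (m<1+n⇒m≤n i<1+m)) ⟩
    ⊕< (suc (m ∸ i)) (λ j → (f i ∧ g (i + j ∸ i)) ∧ h (m ∸ (i + j)))
      ≡⟨ ⊕<-cong (suc (m ∸ i)) (λ j _ → reindex j) ⟩
    ⊕< (suc (m ∸ i)) (λ j → f i ∧ (g j ∧ h (m ∸ i ∸ j)))
      ≡⟨ ⊕<-∧ˡ (suc (m ∸ i)) (f i) (λ j → g j ∧ h (m ∸ i ∸ j)) ⟩
    f i ∧ conv g h (m ∸ i) ∎
    where
    reindex : ∀ j → (f i ∧ g (i + j ∸ i)) ∧ h (m ∸ (i + j)) ≡ f i ∧ (g j ∧ h (m ∸ i ∸ j))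
    reindex j = trans (cong₂ (λ x y → (f i ∧ g x) ∧ h y) (m+n∸m≡n i j) (sym (∸-+-assoc m i j)))
                      (∧-assoc (f i) (g j) _)

conv-xorˡ : ∀ f f′ g → conv (λ i → f i xor f′ i) g ≗ λ m → conv f g m xor conv f′ g m
conv-xorˡ f f′ g m =
  trans (⊕<-cong (suc m) (λ i _ → ∧-distribʳ-xor (g (m ∸ i)) (f i) (f′ i))) (⊕<-xor (suc m) _ _)

conv-∧ˡ : ∀ b f g → conv (λ i → b ∧ f i) g ≗ λ m → b ∧ conv f g m
conv-∧ˡ b f g m =
  trans (⊕<-cong (suc m) (λ i _ → ∧-assoc b (f i) (g (m ∸ i)))) (⊕<-∧ˡ (suc m) b _)

conv-⊕<ˡ : ∀ n (F : ℕ → Seq) g →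
           conv (λ i → ⊕< n (λ j → F j i)) g ≗ λ m → ⊕< n (λ j → conv (F j) g m)
conv-⊕<ˡ n F g m =
  trans (⊕<-cong (suc m) (λ i _ → sym (⊕<-∧ʳ n (g (m ∸ i)) (λ j → F j i))))
        (⊕<-comm (suc m) n (λ i j → F j i ∧ g (m ∸ i)))

conv-identityˡ : ∀ g → conv one g ≗ g
conv-identityˡ g m =
  trans (⊕<-head m (λ i → one i ∧ g (m ∸ i)))
        (trans (cong (g m xor_) (⊕<-false m)) (xor-identityʳ (g m)))

mulX : Seq → Seq
mulX f zero    = false
mulX f (suc m) = f m

mulX-cong : ∀ {f g} → f ≗ g → mulX f ≗ mulX g
mulX-cong f≗g zero    = refl
mulX-cong f≗g (suc m) = f≗g m

mulX-lin : ∀ α β f g → mulX (λ m → (α ∧ f m) xor (β ∧ g m)) ≗ λ m → (α ∧ mulX f m) xor (β ∧ mulX g m)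
mulX-lin α β f g zero    = sym (cong₂ _xor_ (∧-zeroʳ α) (∧-zeroʳ β))
mulX-lin α β f g (suc m) = refl

conv-mulXˡ : ∀ f g → conv (mulX f) g ≗ mulX (conv f g)
conv-mulXˡ f g zero    = refl
conv-mulXˡ f g (suc m) = ⊕<-head (suc m) (λ i → mulX f i ∧ g (suc m ∸ i))

linForm-split : ∀ a c → linForm a c ≗ λ i → (c ∧ one i) xor (a ∧ mulX one i)
linForm-split a c zero          = sym (trans (cong₂ _xor_ (∧-identityʳ c) (∧-zeroʳ a)) (xor-identityʳ c))
linForm-split a c (suc zero)    = sym (trans (cong (_xor (a ∧ true)) (∧-zeroʳ c)) (∧-identityʳ a))
linForm-split a c (suc (suc i)) = sym (cong₂ _xor_ (∧-zeroʳ c) (∧-zeroʳ a))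

conv-linForm : ∀ a c g → conv (linForm a c) g ≗ λ m → (c ∧ g m) xor (a ∧ mulX g m)
conv-linForm a c g m = begin
  conv (linForm a c) g m
    ≡⟨ conv-cong {g = g} (linForm-split a c) (λ _ → refl) m ⟩
  conv (λ i → (c ∧ one i) xor (a ∧ mulX one i)) g m
    ≡⟨ conv-xorˡ (λ i → c ∧ one i) (λ i → a ∧ mulX one i) g m ⟩
  conv (λ i → c ∧ one i) g m xor conv (λ i → a ∧ mulX one i) g m
    ≡⟨ cong₂ _xor_ (conv-∧ˡ c one g m) (conv-∧ˡ a (mulX one) g m) ⟩
  (c ∧ conv one g m) xor (a ∧ conv (mulX one) g m)
    ≡⟨ cong₂ (λ x y → (c ∧ x) xor (a ∧ y)) (conv-identityˡ g m)
             (trans (conv-mulXˡ one g m) (mulX-cong (conv-identityˡ g) m)) ⟩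
  (c ∧ g m) xor (a ∧ mulX g m) ∎
  where open ≡-Reasoning

-- The Frobenius substitution X ↦ X², Y ↦ Y²

frob : Seq → Seq
frob f zero          = f zero
frob f (suc zero)    = false
frob f (suc (suc m)) = frob (λ i → f (suc i)) m

frob-even : ∀ f j → frob f (j + j) ≡ f j
frob-even f zero    = refl
frob-even f (suc j) rewrite +-suc j j = frob-even (λ i → f (suc i)) j

frob-odd : ∀ f j → frob f (suc (j + j)) ≡ false
frob-odd f zero    = refl
frob-odd f (suc j) rewrite +-suc j j = frob-odd (λ i → f (suc i)) j

frob-cong : ∀ {f g} → f ≗ g → frob f ≗ frob g
frob-cong f≗g zero          = f≗g zero
frob-cong f≗g (suc zero)    = refl
frob-cong f≗g (suc (suc m)) = frob-cong (λ i → f≗g (suc i)) m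

frob-xor : ∀ f g → frob (λ i → f i xor g i) ≗ λ m → frob f m xor frob g m
frob-xor f g zero          = refl
frob-xor f g (suc zero)    = refl
frob-xor f g (suc (suc m)) = frob-xor (λ i → f (suc i)) (λ i → g (suc i)) m

frob-∧ : ∀ b f → frob (λ i → b ∧ f i) ≗ λ m → b ∧ frob f m
frob-∧ b f zero          = refl
frob-∧ b f (suc zero)    = sym (∧-zeroʳ b)
frob-∧ b f (suc (suc m)) = frob-∧ b (λ i → f (suc i)) m

frob-lin : ∀ α β f g → frob (λ m → (α ∧ f m) xor (β ∧ g m)) ≗ λ m → (α ∧ frob f m) xor (β ∧ frob g m)
frob-lin α β f g m =
  trans (frob-xor (λ m → α ∧ f m) (λ m → β ∧ g m) m) (cong₂ _xor_ (frob-∧ α f m) (frob-∧ β g m))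

frob-⊕< : ∀ n (F : ℕ → Seq) → frob (λ i → ⊕< n (λ j → F j i)) ≗ λ m → ⊕< n (λ j → frob (F j) m)
frob-⊕< n F zero          = refl
frob-⊕< n F (suc zero)    = sym (⊕<-false n)
frob-⊕< n F (suc (suc m)) = frob-⊕< n (λ j i → F j (suc i)) m

frob-false : frob (λ _ → false) ≗ λ _ → false
frob-false zero          = refl
frob-false (suc zero)    = refl
frob-false (suc (suc m)) = frob-false m

frob-one : frob one ≗ one
frob-one zero          = refl
frob-one (suc zero)    = refl
frob-one (suc (suc m)) = frob-false m

frob-support : ∀ f g → (∀ j → f j ≡ false → g j ≡ false) → ∀ i → frob f i ≡ false → frob g i ≡ false
frob-support f g g⊆f zero          f0≡0 = g⊆f 0 f0≡0
frob-support f g g⊆f (suc zero)    _    = refl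
frob-support f g g⊆f (suc (suc i)) fi≡0 =
  frob-support (λ j → f (suc j)) (λ j → g (suc j)) (λ j → g⊆f (suc j)) i fi≡0

half : ∀ i → Σ ℕ (λ j → (i ≡ j + j) ⊎ (i ≡ suc (j + j)))
half zero = 0 , inj₁ refl
half (suc i) with half i
... | j , inj₁ i≡2j   = j , inj₂ (cong suc i≡2j)
... | j , inj₂ i≡2j+1 = suc j , inj₁ (trans (cong suc i≡2j+1) (cong suc (sym (+-suc j j))))

⊕<-evens : ∀ j f → (∀ i → f (suc (i + i)) ≡ false) → ⊕< (suc (j + j)) f ≡ ⊕< (suc j) (λ i → f (i + i))
⊕<-evens zero    f odd≡0 = refl
⊕<-evens (suc j) f odd≡0 rewrite +-suc j j =
  cong (_xor f (suc (suc (j + j))))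
       (trans (cong₂ _xor_ (⊕<-evens j f odd≡0) (odd≡0 j)) (xor-identityʳ (⊕< (suc j) (λ i → f (i + i)))))

double-∸ : ∀ j l → (j + j) ∸ (l + l) ≡ (j ∸ l) + (j ∸ l)
double-∸ zero    zero    = refl
double-∸ zero    (suc l) = refl
double-∸ (suc j) zero    = refl
double-∸ (suc j) (suc l) rewrite +-suc j j | +-suc l l = double-∸ j l

frob-conv : ∀ f g → frob (conv f g) ≗ conv (frob f) (frob g)
frob-conv f g m with half m
... | j , inj₁ refl = begin
  frob (conv f g) (j + j)                               ≡⟨ frob-even (conv f g) j ⟩
  conv f g j                                            ≡⟨ ⊕<-cong (suc j) (λ i _ → evenTerm i) ⟨
  ⊕< (suc j) (λ i → frob f (i + i) ∧ frob g (j + j ∸ (i + i)))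
    ≡⟨ sym (⊕<-evens j (λ i → frob f i ∧ frob g (j + j ∸ i)) (λ i → cong (_∧ _) (frob-odd f i))) ⟩
  conv (frob f) (frob g) (j + j) ∎
  where
  open ≡-Reasoning
  evenTerm : ∀ i → frob f (i + i) ∧ frob g (j + j ∸ (i + i)) ≡ f i ∧ g (j ∸ i)
  evenTerm i = cong₂ _∧_ (frob-even f i) (trans (cong (frob g) (double-∸ j i)) (frob-even g (j ∸ i)))
... | j , inj₂ refl =
  trans (frob-odd (conv f g) j) (sym (⊕<-vanishes (suc (suc (j + j))) term))
  where
  odd-minus-even : ∀ j l → l + l < suc (suc (j + j)) → frob g (suc (j + j) ∸ (l + l)) ≡ false
  odd-minus-even j       zero    _ = frob-odd g j
  odd-minus-even zero    (suc l) (s≤s (s≤s l+l<0)) rewrite +-suc l l with l+l<0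
  ... | ()
  odd-minus-even (suc j) (suc l) (s≤s (s≤s lt)) rewrite +-suc j j | +-suc l l = odd-minus-even j l lt
  term : ∀ i → i < suc (suc (j + j)) → frob f i ∧ frob g (suc (j + j) ∸ i) ≡ false
  term i i<m with half i
  ... | l , inj₁ refl = trans (cong (frob f (l + l) ∧_) (odd-minus-even j l i<m)) (∧-zeroʳ _)
  ... | l , inj₂ refl = cong (_∧ frob g (suc (j + j) ∸ suc (l + l))) (frob-odd f l)

linForm-square : ∀ a c → conv (linForm a c) (linForm a c) ≗ frob (linForm a c)
linForm-square a c m = trans (conv-linForm a c (linForm a c) m) (coefficient m)
  where
  cross : (c ∧ a) xor (a ∧ c) ≡ false
  cross = trans (cong (_xor (a ∧ c)) (∧-comm c a)) (xor-same (a ∧ c))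
  coefficient : ∀ m → (c ∧ linForm a c m) xor (a ∧ mulX (linForm a c) m) ≡ frob (linForm a c) m
  coefficient zero                      = trans (cong₂ _xor_ (∧-idem c) (∧-zeroʳ a)) (xor-identityʳ c)
  coefficient (suc zero)                = cross
  coefficient (suc (suc zero))          = cong₂ _xor_ (∧-zeroʳ c) (∧-idem a)
  coefficient (suc (suc (suc zero)))    = cong₂ _xor_ (∧-zeroʳ c) (∧-zeroʳ a)
  coefficient (suc (suc (suc (suc m)))) = trans (cong₂ _xor_ (∧-zeroʳ c) (∧-zeroʳ a)) (sym (frob-false m))

pow-linForm-double : ∀ a c n → pow (linForm a c) (n + n) ≗ frob (pow (linForm a c) n)
pow-linForm-double a c zero    m = sym (frob-one m)
pow-linForm-double a c (suc n) m rewrite +-suc n n = begin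
  conv ℓ (conv ℓ (pow ℓ (n + n))) m         ≡⟨ conv-assoc ℓ ℓ (pow ℓ (n + n)) m ⟨
  conv (conv ℓ ℓ) (pow ℓ (n + n)) m         ≡⟨ conv-cong (linForm-square a c) (pow-linForm-double a c n) m ⟩
  conv (frob ℓ) (frob (pow ℓ n)) m          ≡⟨ frob-conv ℓ (pow ℓ n) m ⟨
  frob (conv ℓ (pow ℓ n)) m                 ∎
  where
  open ≡-Reasoning
  ℓ : Seq
  ℓ = linForm a c

-- The substitution P(X, Y) ↦ P(A, B) of forms A, B into a form P of
-- degree k; `act` is this substitution with A = aX + cY, B = bX + dY.

substXY : ℕ → Seq → Seq → Seq → Seq
substXY k A B P m = ⊕< (suc k) (λ i → P i ∧ conv (pow A i) (pow B (k ∸ i)) m)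

substXY-cong : ∀ k A B {P Q} → (∀ i → i ≤ k → P i ≡ Q i) → substXY k A B P ≗ substXY k A B Q
substXY-cong k A B P≡Q m =
  ⊕<-cong (suc k) (λ i i<1+k → cong (_∧ conv (pow A i) (pow B (k ∸ i)) m) (P≡Q i (m<1+n⇒m≤n i<1+k)))

substXY-xor : ∀ k A B P Q →
  substXY k A B (λ i → P i xor Q i) ≗ λ m → substXY k A B P m xor substXY k A B Q m
substXY-xor k A B P Q m =
  trans (⊕<-cong (suc k) (λ i _ → ∧-distribʳ-xor _ (P i) (Q i))) (⊕<-xor (suc k) _ _)

substXY-degree0 : ∀ A B P → substXY 0 A B P ≗ λ m → P 0 ∧ one m
substXY-degree0 A B P m = cong (P 0 ∧_) (conv-identityˡ one m)

substXY-frob : ∀ k a c b d P →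
  substXY (k + k) (linForm a c) (linForm b d) (frob P) ≗ frob (substXY k (linForm a c) (linForm b d) P)
substXY-frob k a c b d P m = begin
  ⊕< (suc (k + k)) (λ i → frob P i ∧ term (k + k) i)
    ≡⟨ ⊕<-evens k _ (λ i → cong (_∧ term (k + k) (suc (i + i))) (frob-odd P i)) ⟩
  ⊕< (suc k) (λ i → frob P (i + i) ∧ term (k + k) (i + i))
    ≡⟨ ⊕<-cong (suc k) (λ i _ → cong₂ _∧_ (frob-even P i) (doubled i)) ⟩
  ⊕< (suc k) (λ i → P i ∧ frob (λ n → conv (pow A i) (pow B (k ∸ i)) n) m)
    ≡⟨ ⊕<-cong (suc k) (λ i _ → sym (frob-∧ (P i) (conv (pow A i) (pow B (k ∸ i))) m)) ⟩
  ⊕< (suc k) (λ i → frob (λ n → P i ∧ conv (pow A i) (pow B (k ∸ i)) n) m)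
    ≡⟨ frob-⊕< (suc k) (λ i n → P i ∧ conv (pow A i) (pow B (k ∸ i)) n) m ⟨
  frob (substXY k A B P) m ∎
  where
  open ≡-Reasoning
  A B : Seq
  A = linForm a c
  B = linForm b d
  term : ℕ → ℕ → Bool
  term n i = conv (pow A i) (pow B (n ∸ i)) m
  doubled : ∀ i → term (k + k) (i + i) ≡ frob (conv (pow A i) (pow B (k ∸ i))) m
  doubled i = trans (conv-cong (pow-linForm-double a c i) powB m) (sym (frob-conv (pow A i) (pow B (k ∸ i)) m))
    where
    powB : pow B (k + k ∸ (i + i)) ≗ frob (pow B (k ∸ i))
    powB n = trans (cong (λ e → pow B e n) (double-∸ k i)) (pow-linForm-double b d (k ∸ i) n)

conv-substXY : ∀ k A B P E → conv E (substXY k A B P) ≗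
               λ m → ⊕< (suc k) (λ i → P i ∧ conv E (conv (pow A i) (pow B (k ∸ i))) m)
conv-substXY k A B P E m =
  trans (conv-comm E _ m)
  (trans (conv-⊕<ˡ (suc k) (λ i n → P i ∧ conv (pow A i) (pow B (k ∸ i)) n) E m)
  (⊕<-cong (suc k) (λ i _ → trans (conv-∧ˡ (P i) (conv (pow A i) (pow B (k ∸ i))) E m)
                                  (cong (P i ∧_) (conv-comm _ E m)))))

substXY-mulX : ∀ k A B P → substXY (suc k) A B (mulX P) ≗ conv A (substXY k A B P)
substXY-mulX k A B P m = begin
  substXY (suc k) A B (mulX P) m
    ≡⟨ ⊕<-head (suc k) _ ⟩
  ⊕< (suc k) (λ i → P i ∧ conv (conv A (pow A i)) (pow B (k ∸ i)) m)
    ≡⟨ ⊕<-cong (suc k) (λ i _ → cong (P i ∧_) (conv-assoc A (pow A i) (pow B (k ∸ i)) m)) ⟩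
  ⊕< (suc k) (λ i → P i ∧ conv A (conv (pow A i) (pow B (k ∸ i))) m)
    ≡⟨ conv-substXY k A B P A m ⟨
  conv A (substXY k A B P) m ∎
  where open ≡-Reasoning

substXY-mulY : ∀ k A B P → P (suc k) ≡ false → substXY (suc k) A B P ≗ conv B (substXY k A B P)
substXY-mulY k A B P top≡0 m = begin
  substXY (suc k) A B P m
    ≡⟨ cong (⊕< (suc k) (λ i → P i ∧ term (suc k) i) xor_) (cong (_∧ term (suc k) (suc k)) top≡0) ⟩
  ⊕< (suc k) (λ i → P i ∧ term (suc k) i) xor false
    ≡⟨ xor-identityʳ _ ⟩
  ⊕< (suc k) (λ i → P i ∧ term (suc k) i)
    ≡⟨ ⊕<-cong (suc k) (λ i i<1+k → cong (P i ∧_) (factorB i (m<1+n⇒m≤n i<1+k))) ⟩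
  ⊕< (suc k) (λ i → P i ∧ conv B (conv (pow A i) (pow B (k ∸ i))) m)
    ≡⟨ conv-substXY k A B P B m ⟨
  conv B (substXY k A B P) m ∎
  where
  open ≡-Reasoning
  term : ℕ → ℕ → Bool
  term n i = conv (pow A i) (pow B (n ∸ i)) m
  factorB : ∀ i → i ≤ k → term (suc k) i ≡ conv B (conv (pow A i) (pow B (k ∸ i))) m
  factorB i i≤k = begin
    conv (pow A i) (pow B (suc k ∸ i)) m         ≡⟨ cong (λ e → conv (pow A i) (pow B e) m) (+-∸-assoc 1 i≤k) ⟩
    conv (pow A i) (conv B (pow B (k ∸ i))) m    ≡⟨ conv-comm (pow A i) _ m ⟩
    conv (conv B (pow B (k ∸ i))) (pow A i) m    ≡⟨ conv-assoc B (pow B (k ∸ i)) (pow A i) m ⟩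
    conv B (conv (pow B (k ∸ i)) (pow A i)) m
      ≡⟨ conv-cong {f = B} (λ _ → refl) (conv-comm (pow B (k ∸ i)) (pow A i)) m ⟩
    conv B (conv (pow A i) (pow B (k ∸ i))) m    ∎

-- The tensor power st^⊗s of the Steinberg module st = F₂X ⊕ F₂Y; a pair
-- (u , u′) stands for u ⊗ Y + u′ ⊗ X.

Tensor : ℕ → Set
Tensor zero    = Bool
Tensor (suc s) = Tensor s × Tensor s

infixl 6 _+ᵀ_
infixr 7 _·ᵀ_

_+ᵀ_ : ∀ {s} → Tensor s → Tensor s → Tensor s
_+ᵀ_ {zero}  x        y        = x xor y
_+ᵀ_ {suc s} (u , u′) (v , v′) = u +ᵀ v , u′ +ᵀ v′

_·ᵀ_ : ∀ {s} → Bool → Tensor s → Tensor s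
_·ᵀ_ {zero}  β x        = β ∧ x
_·ᵀ_ {suc s} β (u , u′) = β ·ᵀ u , β ·ᵀ u′

0ᵀ : ∀ {s} → Tensor s
0ᵀ {zero}  = false
0ᵀ {suc s} = 0ᵀ , 0ᵀ

+ᵀ-comm : ∀ {s} (x y : Tensor s) → x +ᵀ y ≡ y +ᵀ x
+ᵀ-comm {zero}  x        y        = xor-comm x y
+ᵀ-comm {suc s} (u , u′) (v , v′) = cong₂ _,_ (+ᵀ-comm u v) (+ᵀ-comm u′ v′)

+ᵀ-assoc : ∀ {s} (x y z : Tensor s) → (x +ᵀ y) +ᵀ z ≡ x +ᵀ (y +ᵀ z)
+ᵀ-assoc {zero}  x        y        z        = xor-assoc x y z
+ᵀ-assoc {suc s} (u , u′) (v , v′) (w , w′) = cong₂ _,_ (+ᵀ-assoc u v w) (+ᵀ-assoc u′ v′ w′)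

+ᵀ-identityˡ : ∀ {s} (x : Tensor s) → 0ᵀ +ᵀ x ≡ x
+ᵀ-identityˡ {zero}  x        = refl
+ᵀ-identityˡ {suc s} (u , u′) = cong₂ _,_ (+ᵀ-identityˡ u) (+ᵀ-identityˡ u′)

+ᵀ-identityʳ : ∀ {s} (x : Tensor s) → x +ᵀ 0ᵀ ≡ x
+ᵀ-identityʳ x = trans (+ᵀ-comm x 0ᵀ) (+ᵀ-identityˡ x)

+ᵀ-self : ∀ {s} (x : Tensor s) → x +ᵀ x ≡ 0ᵀ
+ᵀ-self {zero}  x        = xor-same x
+ᵀ-self {suc s} (u , u′) = cong₂ _,_ (+ᵀ-self u) (+ᵀ-self u′)

+ᵀ-interchange : ∀ {s} (x y z w : Tensor s) → (x +ᵀ y) +ᵀ (z +ᵀ w) ≡ (x +ᵀ z) +ᵀ (y +ᵀ w)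
+ᵀ-interchange {zero}  x y z w = xor-interchange x y z w
+ᵀ-interchange {suc s} (x , x′) (y , y′) (z , z′) (w , w′) =
  cong₂ _,_ (+ᵀ-interchange x y z w) (+ᵀ-interchange x′ y′ z′ w′)

+ᵀ-cancel : ∀ {s} {x y : Tensor s} → x +ᵀ y ≡ 0ᵀ → x ≡ y
+ᵀ-cancel {x = x} {y} x+y≡0 = begin
  x                  ≡⟨ +ᵀ-identityʳ x ⟨
  x +ᵀ 0ᵀ            ≡⟨ cong (x +ᵀ_) (+ᵀ-self y) ⟨
  x +ᵀ (y +ᵀ y)      ≡⟨ +ᵀ-assoc x y y ⟨
  (x +ᵀ y) +ᵀ y      ≡⟨ cong (_+ᵀ y) x+y≡0 ⟩
  0ᵀ +ᵀ y            ≡⟨ +ᵀ-identityˡ y ⟩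
  y                  ∎
  where open ≡-Reasoning

sum-of-zeros : ∀ {s} {x y : Tensor s} → x ≡ 0ᵀ → y ≡ 0ᵀ → x +ᵀ y ≡ 0ᵀ
sum-of-zeros refl refl = +ᵀ-identityˡ 0ᵀ

sum-with-zeroʳ : ∀ {s} {x y z : Tensor s} → x ≡ z → y ≡ 0ᵀ → x +ᵀ y ≡ z
sum-with-zeroʳ refl refl = +ᵀ-identityʳ _

sum-with-zeroˡ : ∀ {s} {x y z : Tensor s} → x ≡ 0ᵀ → y ≡ z → x +ᵀ y ≡ z
sum-with-zeroˡ refl refl = +ᵀ-identityˡ _

·ᵀ-distribʳ : ∀ {s} β γ (x : Tensor s) → (β xor γ) ·ᵀ x ≡ β ·ᵀ x +ᵀ γ ·ᵀ x
·ᵀ-distribʳ {zero}  β γ x        = ∧-distribʳ-xor x β γ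
·ᵀ-distribʳ {suc s} β γ (u , u′) = cong₂ _,_ (·ᵀ-distribʳ β γ u) (·ᵀ-distribʳ β γ u′)

·ᵀ-zeroˡ : ∀ {s} (x : Tensor s) → false ·ᵀ x ≡ 0ᵀ
·ᵀ-zeroˡ {zero}  x        = refl
·ᵀ-zeroˡ {suc s} (u , u′) = cong₂ _,_ (·ᵀ-zeroˡ u) (·ᵀ-zeroˡ u′)

·ᵀ-identityˡ : ∀ {s} (x : Tensor s) → true ·ᵀ x ≡ x
·ᵀ-identityˡ {zero}  x        = refl
·ᵀ-identityˡ {suc s} (u , u′) = cong₂ _,_ (·ᵀ-identityˡ u) (·ᵀ-identityˡ u′)

-- Linear combinations α x + β y, defined by cases so that they compute
-- for known coefficients.

comb : ∀ {s} → Bool → Bool → Tensor s → Tensor s → Tensor s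
comb true  true  x y = x +ᵀ y
comb true  false x y = x
comb false true  x y = y
comb false false x y = 0ᵀ

comb-lin : ∀ {s} α β (x y : Tensor s) → comb α β x y ≡ α ·ᵀ x +ᵀ β ·ᵀ y
comb-lin true  true  x y = sym (cong₂ _+ᵀ_ (·ᵀ-identityˡ x) (·ᵀ-identityˡ y))
comb-lin true  false x y = sym (trans (cong₂ _+ᵀ_ (·ᵀ-identityˡ x) (·ᵀ-zeroˡ y)) (+ᵀ-identityʳ x))
comb-lin false true  x y = sym (trans (cong₂ _+ᵀ_ (·ᵀ-zeroˡ x) (·ᵀ-identityˡ y)) (+ᵀ-identityˡ y))
comb-lin false false x y = sym (trans (cong₂ _+ᵀ_ (·ᵀ-zeroˡ x) (·ᵀ-zeroˡ y)) (+ᵀ-identityˡ 0ᵀ))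

comb-+ᵀ : ∀ {s} α β (x x′ y y′ : Tensor s) →
          comb α β (x +ᵀ x′) (y +ᵀ y′) ≡ comb α β x y +ᵀ comb α β x′ y′
comb-+ᵀ true  true  x x′ y y′ = +ᵀ-interchange x x′ y y′
comb-+ᵀ true  false x x′ y y′ = refl
comb-+ᵀ false true  x x′ y y′ = refl
comb-+ᵀ false false x x′ y y′ = sym (+ᵀ-identityˡ 0ᵀ)

comb-xor : ∀ {s} α α′ β β′ (x y : Tensor s) →
           comb (α xor α′) (β xor β′) x y ≡ comb α β x y +ᵀ comb α′ β′ x y
comb-xor α α′ β β′ x y = begin
  comb (α xor α′) (β xor β′) x y                     ≡⟨ comb-lin (α xor α′) (β xor β′) x y ⟩
  (α xor α′) ·ᵀ x +ᵀ (β xor β′) ·ᵀ y                 ≡⟨ cong₂ _+ᵀ_ (·ᵀ-distribʳ α α′ x) (·ᵀ-distribʳ β β′ y) ⟩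
  (α ·ᵀ x +ᵀ α′ ·ᵀ x) +ᵀ (β ·ᵀ y +ᵀ β′ ·ᵀ y)        ≡⟨ +ᵀ-interchange (α ·ᵀ x) (α′ ·ᵀ x) (β ·ᵀ y) (β′ ·ᵀ y) ⟩
  (α ·ᵀ x +ᵀ β ·ᵀ y) +ᵀ (α′ ·ᵀ x +ᵀ β′ ·ᵀ y)        ≡⟨ cong₂ _+ᵀ_ (comb-lin α β x y) (comb-lin α′ β′ x y) ⟨
  comb α β x y +ᵀ comb α′ β′ x y                     ∎
  where open ≡-Reasoning

comb-∧ : ∀ {s} γ α β (x y : Tensor s) → comb (γ ∧ α) (γ ∧ β) x y ≡ γ ·ᵀ comb α β x y
comb-∧ true  α β x y = sym (·ᵀ-identityˡ _)
comb-∧ false α β x y = sym (·ᵀ-zeroˡ _)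

comb-comb : ∀ {s} α β γ δ ε ζ (x y : Tensor s) →
  comb α β (comb γ δ x y) (comb ε ζ x y) ≡ comb ((α ∧ γ) xor (β ∧ ε)) ((α ∧ δ) xor (β ∧ ζ)) x y
comb-comb true  true  γ δ ε ζ x y = sym (comb-xor γ ε δ ζ x y)
comb-comb true  false γ δ ε ζ x y = sym (cong₂ (λ α β → comb α β x y) (xor-identityʳ γ) (xor-identityʳ δ))
comb-comb false true  γ δ ε ζ x y = refl
comb-comb false false γ δ ε ζ x y = refl

-- The action of 2×2 matrices on st^⊗s: g Y = bX + dY and g X = aX + cY.

infixl 7 _*ᴹ_
_*ᴹ_ : Mat → Mat → Mat
mat a b c d *ᴹ mat a′ b′ c′ d′ =
  mat ((a ∧ a′) xor (b ∧ c′)) ((a ∧ b′) xor (b ∧ d′)) ((c ∧ a′) xor (d ∧ c′)) ((c ∧ b′) xor (d ∧ d′))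

ρ : ∀ {s} → Mat → Tensor s → Tensor s
ρ {zero}  g v        = v
ρ {suc s} g (u , u′) = comb (d g) (c g) (ρ g u) (ρ g u′) , comb (b g) (a g) (ρ g u) (ρ g u′)

ρ-+ᵀ : ∀ {s} g (x y : Tensor s) → ρ g (x +ᵀ y) ≡ ρ g x +ᵀ ρ g y
ρ-+ᵀ {zero}  g x        y        = refl
ρ-+ᵀ {suc s} g (u , u′) (v , v′) = cong₂ _,_
  (trans (cong₂ (comb (d g) (c g)) (ρ-+ᵀ g u v) (ρ-+ᵀ g u′ v′)) (comb-+ᵀ (d g) (c g) _ _ _ _))
  (trans (cong₂ (comb (b g) (a g)) (ρ-+ᵀ g u v) (ρ-+ᵀ g u′ v′)) (comb-+ᵀ (b g) (a g) _ _ _ _))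

ρ-0ᵀ : ∀ {s} g → ρ g (0ᵀ {s}) ≡ 0ᵀ
ρ-0ᵀ g = begin
  ρ g 0ᵀ                  ≡⟨ cong (ρ g) (+ᵀ-self 0ᵀ) ⟨
  ρ g (0ᵀ +ᵀ 0ᵀ)          ≡⟨ ρ-+ᵀ g 0ᵀ 0ᵀ ⟩
  ρ g 0ᵀ +ᵀ ρ g 0ᵀ        ≡⟨ +ᵀ-self (ρ g 0ᵀ) ⟩
  0ᵀ                      ∎
  where open ≡-Reasoning

ρ-comb : ∀ {s} g α β (x y : Tensor s) → ρ g (comb α β x y) ≡ comb α β (ρ g x) (ρ g y)
ρ-comb g true  true  x y = ρ-+ᵀ g x y
ρ-comb g true  false x y = refl
ρ-comb g false true  x y = refl
ρ-comb g false false x y = ρ-0ᵀ g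

ρ-*ᴹ : ∀ {s} g h (v : Tensor s) → ρ (g *ᴹ h) v ≡ ρ g (ρ h v)
ρ-*ᴹ {zero}  g h v = refl
ρ-*ᴹ {suc s} g@(mat a b c d) h@(mat a′ b′ c′ d′) (u , u′) = cong₂ _,_ (row d c) (row b a)
  where
  x x′ : Tensor s
  x  = ρ g (ρ h u)
  x′ = ρ g (ρ h u′)
  row : ∀ p q → comb ((q ∧ b′) xor (p ∧ d′)) ((q ∧ a′) xor (p ∧ c′)) (ρ (g *ᴹ h) u) (ρ (g *ᴹ h) u′)
              ≡ comb p q (ρ g (comb d′ c′ (ρ h u) (ρ h u′))) (ρ g (comb b′ a′ (ρ h u) (ρ h u′)))
  row p q = begin
    comb ((q ∧ b′) xor (p ∧ d′)) ((q ∧ a′) xor (p ∧ c′)) (ρ (g *ᴹ h) u) (ρ (g *ᴹ h) u′)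
      ≡⟨ cong₂ (comb ((q ∧ b′) xor (p ∧ d′)) ((q ∧ a′) xor (p ∧ c′))) (ρ-*ᴹ g h u) (ρ-*ᴹ g h u′) ⟩
    comb ((q ∧ b′) xor (p ∧ d′)) ((q ∧ a′) xor (p ∧ c′)) x x′
      ≡⟨ cong₂ (λ α β → comb α β x x′) (xor-comm (q ∧ b′) (p ∧ d′)) (xor-comm (q ∧ a′) (p ∧ c′)) ⟩
    comb ((p ∧ d′) xor (q ∧ b′)) ((p ∧ c′) xor (q ∧ a′)) x x′
      ≡⟨ comb-comb p q d′ c′ b′ a′ x x′ ⟨
    comb p q (comb d′ c′ x x′) (comb b′ a′ x x′)
      ≡⟨ cong₂ (comb p q) (ρ-comb g d′ c′ (ρ h u) (ρ h u′)) (ρ-comb g b′ a′ (ρ h u) (ρ h u′)) ⟨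
    comb p q (ρ g (comb d′ c′ (ρ h u) (ρ h u′))) (ρ g (comb b′ a′ (ρ h u) (ρ h u′))) ∎
    where open ≡-Reasoning

I S T R R² : Mat
I  = mat true  false false true
S  = mat false true  true  false
T  = mat true  true  false true
R  = mat true  true  true  false
R² = R *ᴹ R

ρ-I : ∀ {s} (v : Tensor s) → ρ I v ≡ v
ρ-I {zero}  v        = refl
ρ-I {suc s} (u , u′) = cong₂ _,_ (ρ-I u) (ρ-I u′)

-- Formal sums of matrices, i.e. elements of the monoid algebra F₂[M₂(F₂)], acting on st^⊗s.
-- Repetitions are allowed: only the parity of the multiplicity of each matrix matters, so
-- identities between concrete formal sums can be decided by comparing normal forms.

FSum : Set
FSum = List Mat

infixl 7 _⊛_
_⊛_ : FSum → FSum → FSum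
_⊛_ = cartesianProductWith _*ᴹ_

_==ᴹ_ : Mat → Mat → Bool
mat a b c d ==ᴹ mat a′ b′ c′ d′ = does (a ≟ a′) ∧ does (b ≟ b′) ∧ does (c ≟ c′) ∧ does (d ≟ d′)

parity : FSum → Mat → Bool
parity α g = foldr (λ h p → (h ==ᴹ g) xor p) false α

allMats : List Mat
allMats = concatMap (λ a → concatMap (λ b → concatMap (λ c → map (mat a b c) bools) bools) bools) bools
  where
  bools : List Bool
  bools = true ∷ false ∷ []

normal : FSum → FSum
normal α = filterᵇ (parity α) allMats

infix 4 _≈_
_≈_ : FSum → FSum → Set
α ≈ β = normal α ≡ normal β

-- ⟦_⟧ is opaque so that ⟦ α ⟧ v does not unfold for concrete α: this lets α be inferred
-- from goals in the lemmas on ideals below, where it is then checked by `refl` on normal forms.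
opaque
  ⟦_⟧ : ∀ {s} → FSum → Tensor s → Tensor s
  ⟦ []    ⟧ v = 0ᵀ
  ⟦ g ∷ α ⟧ v = ρ g v +ᵀ ⟦ α ⟧ v

  ⟦⟧-[] : ∀ {s} (v : Tensor s) → ⟦ [] ⟧ v ≡ 0ᵀ
  ⟦⟧-[] v = refl

  ⟦⟧-∷ : ∀ {s} g α (v : Tensor s) → ⟦ g ∷ α ⟧ v ≡ ρ g v +ᵀ ⟦ α ⟧ v
  ⟦⟧-∷ g α v = refl

  ⟦⟧-++ : ∀ {s} α β (v : Tensor s) → ⟦ α ++ β ⟧ v ≡ ⟦ α ⟧ v +ᵀ ⟦ β ⟧ v
  ⟦⟧-++ []      β v = sym (+ᵀ-identityˡ (⟦ β ⟧ v))
  ⟦⟧-++ (g ∷ α) β v = trans (cong (ρ g v +ᵀ_) (⟦⟧-++ α β v)) (sym (+ᵀ-assoc _ _ _))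

  ⟦⟧-+ᵀ : ∀ {s} α (x y : Tensor s) → ⟦ α ⟧ (x +ᵀ y) ≡ ⟦ α ⟧ x +ᵀ ⟦ α ⟧ y
  ⟦⟧-+ᵀ []      x y = sym (+ᵀ-identityˡ 0ᵀ)
  ⟦⟧-+ᵀ (g ∷ α) x y =
    trans (cong₂ _+ᵀ_ (ρ-+ᵀ g x y) (⟦⟧-+ᵀ α x y)) (+ᵀ-interchange _ _ _ _)

  ⟦⟧-0ᵀ : ∀ {s} α → ⟦ α ⟧ (0ᵀ {s}) ≡ 0ᵀ
  ⟦⟧-0ᵀ []      = refl
  ⟦⟧-0ᵀ (g ∷ α) = trans (cong₂ _+ᵀ_ (ρ-0ᵀ g) (⟦⟧-0ᵀ α)) (+ᵀ-identityˡ 0ᵀ)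

  ⟦⟧-ρ : ∀ {s} g α (v : Tensor s) → ⟦ map (g *ᴹ_) α ⟧ v ≡ ρ g (⟦ α ⟧ v)
  ⟦⟧-ρ g []      v = sym (ρ-0ᵀ g)
  ⟦⟧-ρ g (h ∷ α) v =
    trans (cong₂ _+ᵀ_ (ρ-*ᴹ g h v) (⟦⟧-ρ g α v)) (sym (ρ-+ᵀ g (ρ h v) (⟦ α ⟧ v)))

  ⟦⟧-⊛ : ∀ {s} α β (v : Tensor s) → ⟦ α ⊛ β ⟧ v ≡ ⟦ α ⟧ (⟦ β ⟧ v)
  ⟦⟧-⊛ []      β v = refl
  ⟦⟧-⊛ (g ∷ α) β v =
    trans (⟦⟧-++ (map (g *ᴹ_) β) (α ⊛ β) v) (cong₂ _+ᵀ_ (⟦⟧-ρ g β v) (⟦⟧-⊛ α β v))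

  ⟦⟧-filter-∷ : ∀ {s} p g α (v : Tensor s) →
                ⟦ filterᵇ p (g ∷ α) ⟧ v ≡ p g ·ᵀ ρ g v +ᵀ ⟦ filterᵇ p α ⟧ v
  ⟦⟧-filter-∷ p g α v with p g
  ... | true  = cong (_+ᵀ ⟦ filterᵇ p α ⟧ v) (sym (·ᵀ-identityˡ (ρ g v)))
  ... | false = sym (trans (cong (_+ᵀ ⟦ filterᵇ p α ⟧ v) (·ᵀ-zeroˡ (ρ g v))) (+ᵀ-identityˡ _))

  -- By g Y = bX + dY and g X = aX + cY, the entries d, c (b, a) of g feed the Y- (X-) part.
  ⟦⟧-block : ∀ {s} α (u u′ : Tensor s) →
    ⟦ α ⟧ (u , u′) ≡ (⟦ filterᵇ d α ⟧ u +ᵀ ⟦ filterᵇ c α ⟧ u′ , ⟦ filterᵇ b α ⟧ u +ᵀ ⟦ filterᵇ a α ⟧ u′)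
  ⟦⟧-block []      u u′ = sym (cong₂ _,_ (+ᵀ-identityˡ 0ᵀ) (+ᵀ-identityˡ 0ᵀ))
  ⟦⟧-block (g ∷ α) u u′ = cong₂ _,_
    (trans (cong (comb (d g) (c g) (ρ g u) (ρ g u′) +ᵀ_) (cong proj₁ (⟦⟧-block α u u′))) (row d c))
    (trans (cong (comb (b g) (a g) (ρ g u) (ρ g u′) +ᵀ_) (cong proj₂ (⟦⟧-block α u u′))) (row b a))
    where
    row : ∀ p q → comb (p g) (q g) (ρ g u) (ρ g u′) +ᵀ (⟦ filterᵇ p α ⟧ u +ᵀ ⟦ filterᵇ q α ⟧ u′)
                ≡ ⟦ filterᵇ p (g ∷ α) ⟧ u +ᵀ ⟦ filterᵇ q (g ∷ α) ⟧ u′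
    row p q = begin
      comb (p g) (q g) (ρ g u) (ρ g u′) +ᵀ (⟦ filterᵇ p α ⟧ u +ᵀ ⟦ filterᵇ q α ⟧ u′)
        ≡⟨ cong (_+ᵀ _) (comb-lin (p g) (q g) (ρ g u) (ρ g u′)) ⟩
      (p g ·ᵀ ρ g u +ᵀ q g ·ᵀ ρ g u′) +ᵀ (⟦ filterᵇ p α ⟧ u +ᵀ ⟦ filterᵇ q α ⟧ u′)
        ≡⟨ +ᵀ-interchange _ _ _ _ ⟩
      (p g ·ᵀ ρ g u +ᵀ ⟦ filterᵇ p α ⟧ u) +ᵀ (q g ·ᵀ ρ g u′ +ᵀ ⟦ filterᵇ q α ⟧ u′)
        ≡⟨ cong₂ _+ᵀ_ (⟦⟧-filter-∷ p g α u) (⟦⟧-filter-∷ q g α u′) ⟨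
      ⟦ filterᵇ p (g ∷ α) ⟧ u +ᵀ ⟦ filterᵇ q (g ∷ α) ⟧ u′ ∎
      where open ≡-Reasoning

  ⟦⟧-filter-xor : ∀ {s} p q L (v : Tensor s) →
    ⟦ filterᵇ (λ g → p g xor q g) L ⟧ v ≡ ⟦ filterᵇ p L ⟧ v +ᵀ ⟦ filterᵇ q L ⟧ v
  ⟦⟧-filter-xor p q []      v = sym (+ᵀ-identityˡ 0ᵀ)
  ⟦⟧-filter-xor p q (g ∷ L) v = begin
    ⟦ filterᵇ (λ h → p h xor q h) (g ∷ L) ⟧ v
      ≡⟨ ⟦⟧-filter-∷ (λ h → p h xor q h) g L v ⟩
    (p g xor q g) ·ᵀ ρ g v +ᵀ ⟦ filterᵇ (λ h → p h xor q h) L ⟧ v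
      ≡⟨ cong₂ _+ᵀ_ (·ᵀ-distribʳ (p g) (q g) (ρ g v)) (⟦⟧-filter-xor p q L v) ⟩
    (p g ·ᵀ ρ g v +ᵀ q g ·ᵀ ρ g v) +ᵀ (⟦ filterᵇ p L ⟧ v +ᵀ ⟦ filterᵇ q L ⟧ v)
      ≡⟨ +ᵀ-interchange _ _ _ _ ⟩
    (p g ·ᵀ ρ g v +ᵀ ⟦ filterᵇ p L ⟧ v) +ᵀ (q g ·ᵀ ρ g v +ᵀ ⟦ filterᵇ q L ⟧ v)
      ≡⟨ cong₂ _+ᵀ_ (⟦⟧-filter-∷ p g L v) (⟦⟧-filter-∷ q g L v) ⟨
    ⟦ filterᵇ p (g ∷ L) ⟧ v +ᵀ ⟦ filterᵇ q (g ∷ L) ⟧ v ∎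
    where open ≡-Reasoning

  ⟦⟧-point : ∀ {s} h (v : Tensor s) → ⟦ filterᵇ (h ==ᴹ_) allMats ⟧ v ≡ ρ h v
  ⟦⟧-point (mat true  true  true  true ) v = +ᵀ-identityʳ _
  ⟦⟧-point (mat true  true  true  false) v = +ᵀ-identityʳ _
  ⟦⟧-point (mat true  true  false true ) v = +ᵀ-identityʳ _
  ⟦⟧-point (mat true  true  false false) v = +ᵀ-identityʳ _
  ⟦⟧-point (mat true  false true  true ) v = +ᵀ-identityʳ _
  ⟦⟧-point (mat true  false true  false) v = +ᵀ-identityʳ _
  ⟦⟧-point (mat true  false false true ) v = +ᵀ-identityʳ _
  ⟦⟧-point (mat true  false false false) v = +ᵀ-identityʳ _
  ⟦⟧-point (mat false true  true  true ) v = +ᵀ-identityʳ _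
  ⟦⟧-point (mat false true  true  false) v = +ᵀ-identityʳ _
  ⟦⟧-point (mat false true  false true ) v = +ᵀ-identityʳ _
  ⟦⟧-point (mat false true  false false) v = +ᵀ-identityʳ _
  ⟦⟧-point (mat false false true  true ) v = +ᵀ-identityʳ _
  ⟦⟧-point (mat false false true  false) v = +ᵀ-identityʳ _
  ⟦⟧-point (mat false false false true ) v = +ᵀ-identityʳ _
  ⟦⟧-point (mat false false false false) v = +ᵀ-identityʳ _

  ⟦⟧-normal : ∀ {s} α (v : Tensor s) → ⟦ normal α ⟧ v ≡ ⟦ α ⟧ v
  ⟦⟧-normal []      v = refl
  ⟦⟧-normal (h ∷ α) v =
    trans (⟦⟧-filter-xor (h ==ᴹ_) (parity α) allMats v)
          (cong₂ _+ᵀ_ (⟦⟧-point h v) (⟦⟧-normal α v))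

⟦⟧-≈ : ∀ {s} α β → α ≈ β → (v : Tensor s) → ⟦ α ⟧ v ≡ ⟦ β ⟧ v
⟦⟧-≈ α β α≈β v = trans (sym (⟦⟧-normal α v)) (trans (cong (λ γ → ⟦ γ ⟧ v) α≈β) (⟦⟧-normal β v))

⟦⟧-⊛-vanishes : ∀ {s} α β → α ⊛ β ≈ [] → (v : Tensor s) → ⟦ α ⟧ (⟦ β ⟧ v) ≡ 0ᵀ
⟦⟧-⊛-vanishes α β αβ≈[] v = trans (sym (⟦⟧-⊛ α β v)) (trans (⟦⟧-≈ (α ⊛ β) [] αβ≈[] v) (⟦⟧-[] v))

⟦⟧-after : ∀ {s} γ α δ β (v : Tensor s) → ⟦ γ ⟧ (⟦ α ⟧ v) +ᵀ ⟦ δ ⟧ (⟦ β ⟧ v) ≡ ⟦ γ ⊛ α ++ δ ⊛ β ⟧ v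
⟦⟧-after γ α δ β v = sym (trans (⟦⟧-++ (γ ⊛ α) (δ ⊛ β) v) (cong₂ _+ᵀ_ (⟦⟧-⊛ γ α v) (⟦⟧-⊛ δ β v)))

1+S 1+T 1+R 1+S+R 1+R+R² : FSum
1+S    = I ∷ S ∷ []
1+T    = I ∷ T ∷ []
1+R    = I ∷ R ∷ []
1+S+R  = I ∷ S ∷ R ∷ []
1+R+R² = I ∷ R ∷ R² ∷ []

⟦[_]⟧ : ∀ {s} g (v : Tensor s) → ⟦ [ g ] ⟧ v ≡ ρ g v
⟦[ g ]⟧ v = trans (⟦⟧-∷ g [] v) (trans (cong (ρ g v +ᵀ_) (⟦⟧-[] v)) (+ᵀ-identityʳ (ρ g v)))

⟦[I]⟧ : ∀ {s} (v : Tensor s) → ⟦ [ I ] ⟧ v ≡ v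
⟦[I]⟧ v = trans (⟦[ I ]⟧ v) (ρ-I v)

combination : List FSum → List FSum → FSum
combination (κ ∷ κs) (γ ∷ γs) = κ ⊛ γ ++ combination κs γs
combination _        _        = []

Annihilated : ∀ {s} → List FSum → Tensor s → Set
Annihilated γs v = All (λ γ → ⟦ γ ⟧ v ≡ 0ᵀ) γs

⟦⟧-combination : ∀ {s γs} {v : Tensor s} → Annihilated γs v → ∀ κs → ⟦ combination κs γs ⟧ v ≡ 0ᵀ
⟦⟧-combination {v = v} _   []       = ⟦⟧-[] v
⟦⟧-combination {v = v} []   (_ ∷ _)  = ⟦⟧-[] v
⟦⟧-combination {v = v} (γv≡0 ∷ ann) (κ ∷ κs) =
  trans (⟦⟧-++ (κ ⊛ _) _ v)
        (trans (cong₂ _+ᵀ_ (trans (⟦⟧-⊛ κ _ v) (trans (cong ⟦ κ ⟧ γv≡0) (⟦⟧-0ᵀ κ))) (⟦⟧-combination ann κs))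
               (+ᵀ-identityˡ 0ᵀ))

annihilates : ∀ {s γs} {v : Tensor s} → Annihilated γs v → ∀ κs {α} → α ≈ combination κs γs → ⟦ α ⟧ v ≡ 0ᵀ
annihilates {γs = γs} {v} ann κs {α} α≈ = trans (⟦⟧-≈ α (combination κs γs) α≈ v) (⟦⟧-combination ann κs)

agree : ∀ {s γs} {v : Tensor s} → Annihilated γs v → ∀ κs {α β} → α ++ β ≈ combination κs γs → ⟦ α ⟧ v ≡ ⟦ β ⟧ v
agree {v = v} ann κs {α} {β} α+β≈ =
  +ᵀ-cancel (trans (sym (⟦⟧-++ α β v)) (annihilates ann κs {α ++ β} α+β≈))

fixes : ∀ {s γs} {v : Tensor s} → Annihilated γs v → ∀ κs {α} → α ++ [ I ] ≈ combination κs γs → ⟦ α ⟧ v ≡ v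
fixes {v = v} ann κs {α} α+1≈ = trans (agree ann κs {α} {[ I ]} α+1≈) (⟦[I]⟧ v)

Related : ∀ {s} → FSum × FSum → Tensor (suc s) → Set
Related (e , f) (u , u′) = ⟦ e ⟧ u +ᵀ ⟦ f ⟧ u′ ≡ 0ᵀ

rows : FSum → List (FSum × FSum)
rows α = (filterᵇ d α , filterᵇ c α) ∷ (filterᵇ b α , filterᵇ a α) ∷ []

related-rows : ∀ {s} α (v : Tensor (suc s)) → ⟦ α ⟧ v ≡ 0ᵀ → All (λ r → Related r v) (rows α)
related-rows α (u , u′) αv≡0 =
  cong proj₁ (trans (sym (⟦⟧-block α u u′)) αv≡0) ∷ cong proj₂ (trans (sym (⟦⟧-block α u u′)) αv≡0) ∷ []

relationsOf : List FSum → List (FSum × FSum)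
relationsOf = concatMap rows

related-relationsOf : ∀ {s γs} {v : Tensor (suc s)} → Annihilated γs v → All (λ r → Related r v) (relationsOf γs)
related-relationsOf {γs = []}     []           = []
related-relationsOf {γs = γ ∷ γs} {v} (γv≡0 ∷ ann) = ++⁺ (related-rows γ v γv≡0) (related-relationsOf ann)

related-combination : ∀ {s rs} {v : Tensor (suc s)} → All (λ r → Related r v) rs → ∀ κs →
  Related (combination κs (map proj₁ rs) , combination κs (map proj₂ rs)) v
related-combination {v = u , u′} _  []      = trans (cong₂ _+ᵀ_ (⟦⟧-[] u) (⟦⟧-[] u′)) (+ᵀ-identityˡ 0ᵀ)
related-combination {v = u , u′} [] (_ ∷ _) = trans (cong₂ _+ᵀ_ (⟦⟧-[] u) (⟦⟧-[] u′)) (+ᵀ-identityˡ 0ᵀ)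
related-combination {rs = (e , f) ∷ rs} {u , u′} (r ∷ rel) (κ ∷ κs) = begin
  ⟦ κ ⊛ e ++ E ⟧ u +ᵀ ⟦ κ ⊛ f ++ F ⟧ u′
    ≡⟨ cong₂ _+ᵀ_ (⟦⟧-++ (κ ⊛ e) E u) (⟦⟧-++ (κ ⊛ f) F u′) ⟩
  (⟦ κ ⊛ e ⟧ u +ᵀ ⟦ E ⟧ u) +ᵀ (⟦ κ ⊛ f ⟧ u′ +ᵀ ⟦ F ⟧ u′)
    ≡⟨ +ᵀ-interchange _ _ _ _ ⟩
  (⟦ κ ⊛ e ⟧ u +ᵀ ⟦ κ ⊛ f ⟧ u′) +ᵀ (⟦ E ⟧ u +ᵀ ⟦ F ⟧ u′)
    ≡⟨ cong₂ _+ᵀ_ (trans (cong₂ _+ᵀ_ (⟦⟧-⊛ κ e u) (⟦⟧-⊛ κ f u′))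
                         (trans (sym (⟦⟧-+ᵀ κ _ _)) (trans (cong ⟦ κ ⟧ r) (⟦⟧-0ᵀ κ))))
                  (related-combination rel κs) ⟩
  0ᵀ +ᵀ 0ᵀ
    ≡⟨ +ᵀ-identityˡ 0ᵀ ⟩
  0ᵀ ∎
  where
  open ≡-Reasoning
  E F : FSum
  E = combination κs (map proj₁ rs)
  F = combination κs (map proj₂ rs)

relation : ∀ {s γs} {v : Tensor (suc s)} → Annihilated γs v → ∀ κs {e f} →
  e ≈ combination κs (map proj₁ (relationsOf γs)) → f ≈ combination κs (map proj₂ (relationsOf γs)) →
  Related (e , f) v
relation {γs = γs} {u , u′} ann κs {e} {f} e≈ f≈ =
  trans (cong₂ _+ᵀ_ (⟦⟧-≈ e (combination κs (map proj₁ (relationsOf γs))) e≈ u)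
                    (⟦⟧-≈ f (combination κs (map proj₂ (relationsOf γs))) f≈ u′))
        (related-combination (related-relationsOf ann) κs)

Related-[I] : ∀ {s f} {u u′ : Tensor s} → Related ([ I ] , f) (u , u′) → u ≡ ⟦ f ⟧ u′
Related-[I] {f = f} {u} {u′} r = +ᵀ-cancel (trans (cong (_+ᵀ ⟦ f ⟧ u′) (sym (⟦[I]⟧ u))) r)

Related-[] : ∀ {s f} {u u′ : Tensor s} → Related ([] , f) (u , u′) → ⟦ f ⟧ u′ ≡ 0ᵀ
Related-[] {f = f} {u} {u′} r = trans (sym (+ᵀ-identityˡ (⟦ f ⟧ u′))) (trans (cong (_+ᵀ ⟦ f ⟧ u′) (sym (⟦⟧-[] u))) r)

Related-fixes : ∀ {s f} {u u′ : Tensor s} → Related ([] , f ++ [ I ]) (u , u′) → ⟦ f ⟧ u′ ≡ u′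
Related-fixes {f = f} {u′ = u′} r = +ᵀ-cancel (begin
  ⟦ f ⟧ u′ +ᵀ u′              ≡⟨ cong (⟦ f ⟧ u′ +ᵀ_) (⟦[I]⟧ u′) ⟨
  ⟦ f ⟧ u′ +ᵀ ⟦ [ I ] ⟧ u′    ≡⟨ ⟦⟧-++ f [ I ] u′ ⟨
  ⟦ f ++ [ I ] ⟧ u′           ≡⟨ Related-[] {f = f ++ [ I ]} r ⟩
  0ᵀ                          ∎)
  where open ≡-Reasoning

pair : ∀ {s} → FSum → FSum → FSum → FSum → Tensor s → Tensor s → Tensor (suc s)
pair γ₁ γ₂ γ₃ γ₄ x y = ⟦ γ₁ ⟧ x +ᵀ ⟦ γ₂ ⟧ y , ⟦ γ₃ ⟧ x +ᵀ ⟦ γ₄ ⟧ y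

⟦⟧-row : ∀ {s} α γ δ (x y : Tensor s) → ⟦ α ⟧ (⟦ γ ⟧ x +ᵀ ⟦ δ ⟧ y) ≡ ⟦ α ⊛ γ ⟧ x +ᵀ ⟦ α ⊛ δ ⟧ y
⟦⟧-row α γ δ x y = trans (⟦⟧-+ᵀ α _ _) (sym (cong₂ _+ᵀ_ (⟦⟧-⊛ α γ x) (⟦⟧-⊛ α δ y)))

⟦⟧-row-++ : ∀ {s} γ δ γ′ δ′ (x y : Tensor s) →
  (⟦ γ ⟧ x +ᵀ ⟦ δ ⟧ y) +ᵀ (⟦ γ′ ⟧ x +ᵀ ⟦ δ′ ⟧ y) ≡ ⟦ γ ++ γ′ ⟧ x +ᵀ ⟦ δ ++ δ′ ⟧ y
⟦⟧-row-++ γ δ γ′ δ′ x y =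
  trans (+ᵀ-interchange _ _ _ _) (sym (cong₂ _+ᵀ_ (⟦⟧-++ γ γ′ x) (⟦⟧-++ δ δ′ y)))

⟦⟧-pair : ∀ {s} α γ₁ γ₂ γ₃ γ₄ (x y : Tensor s) → ⟦ α ⟧ (pair γ₁ γ₂ γ₃ γ₄ x y) ≡
  pair (filterᵇ d α ⊛ γ₁ ++ filterᵇ c α ⊛ γ₃) (filterᵇ d α ⊛ γ₂ ++ filterᵇ c α ⊛ γ₄)
       (filterᵇ b α ⊛ γ₁ ++ filterᵇ a α ⊛ γ₃) (filterᵇ b α ⊛ γ₂ ++ filterᵇ a α ⊛ γ₄) x y
⟦⟧-pair α γ₁ γ₂ γ₃ γ₄ x y = trans (⟦⟧-block α _ _) (cong₂ _,_ (component d c) (component b a))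
  where
  component : ∀ p q → ⟦ filterᵇ p α ⟧ (⟦ γ₁ ⟧ x +ᵀ ⟦ γ₂ ⟧ y) +ᵀ ⟦ filterᵇ q α ⟧ (⟦ γ₃ ⟧ x +ᵀ ⟦ γ₄ ⟧ y)
                    ≡ ⟦ filterᵇ p α ⊛ γ₁ ++ filterᵇ q α ⊛ γ₃ ⟧ x +ᵀ ⟦ filterᵇ p α ⊛ γ₂ ++ filterᵇ q α ⊛ γ₄ ⟧ y
  component p q = trans (cong₂ _+ᵀ_ (⟦⟧-row (filterᵇ p α) γ₁ γ₂ x y) (⟦⟧-row (filterᵇ q α) γ₃ γ₄ x y))
                        (⟦⟧-row-++ (filterᵇ p α ⊛ γ₁) (filterᵇ p α ⊛ γ₂) (filterᵇ q α ⊛ γ₃) (filterᵇ q α ⊛ γ₄) x y)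

pair-+ᵀ : ∀ {s} γ₁ γ₂ γ₃ γ₄ (x x′ y y′ : Tensor s) →
  pair γ₁ γ₂ γ₃ γ₄ (x +ᵀ x′) (y +ᵀ y′) ≡ pair γ₁ γ₂ γ₃ γ₄ x y +ᵀ pair γ₁ γ₂ γ₃ γ₄ x′ y′
pair-+ᵀ γ₁ γ₂ γ₃ γ₄ x x′ y y′ = cong₂ _,_ (lin γ₁ γ₂) (lin γ₃ γ₄)
  where
  lin : ∀ γ δ → ⟦ γ ⟧ (x +ᵀ x′) +ᵀ ⟦ δ ⟧ (y +ᵀ y′) ≡ (⟦ γ ⟧ x +ᵀ ⟦ δ ⟧ y) +ᵀ (⟦ γ ⟧ x′ +ᵀ ⟦ δ ⟧ y′)
  lin γ δ = trans (cong₂ _+ᵀ_ (⟦⟧-+ᵀ γ x x′) (⟦⟧-+ᵀ δ y y′)) (+ᵀ-interchange _ _ _ _)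

pair-vanishes : ∀ {s γ₁ γ₂ γ₃ γ₄} {x y : Tensor s} →
  ⟦ γ₁ ⟧ x ≡ 0ᵀ → ⟦ γ₂ ⟧ y ≡ 0ᵀ → ⟦ γ₃ ⟧ x ≡ 0ᵀ → ⟦ γ₄ ⟧ y ≡ 0ᵀ → pair γ₁ γ₂ γ₃ γ₄ x y ≡ 0ᵀ
pair-vanishes p q r t = cong₂ _,_ (sum-of-zeros p q) (sum-of-zeros r t)

record Coordinates {s} (P : Tensor s → Set) (n : ℕ) : Set where
  field
    embed        : Vec Bool n → Tensor s
    embed-xor    : ∀ c c′ → embed (zipWith _xor_ c c′) ≡ embed c +ᵀ embed c′
    embed-∈      : ∀ c → P (embed c)
    coords       : Tensor s → Vec Bool n
    coords-embed : ∀ c → coords (embed c) ≡ c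
    embed-coords : ∀ {v} → P v → embed (coords v) ≡ v

record Splitting {s} (P₁ P₂ : Tensor s → Set) (P : Tensor (suc s) → Set) : Set where
  field
    join        : Tensor s → Tensor s → Tensor (suc s)
    join-+ᵀ     : ∀ x x′ y y′ → join (x +ᵀ x′) (y +ᵀ y′) ≡ join x y +ᵀ join x′ y′
    join-∈      : ∀ {x y} → P₁ x → P₂ y → P (join x y)
    split₁      : Tensor (suc s) → Tensor s
    split₂      : Tensor (suc s) → Tensor s
    split₁-∈    : ∀ {v} → P v → P₁ (split₁ v)
    split₂-∈    : ∀ {v} → P v → P₂ (split₂ v)
    split₁-join : ∀ {x y} → P₁ x → P₂ y → split₁ (join x y) ≡ x
    split₂-join : ∀ {x y} → P₁ x → P₂ y → split₂ (join x y) ≡ y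
    join-split  : ∀ {v} → P v → join (split₁ v) (split₂ v) ≡ v

coordinates-split : ∀ {s m n} {P₁ P₂ : Tensor s → Set} {P : Tensor (suc s) → Set} →
  Coordinates P₁ m → Coordinates P₂ n → Splitting P₁ P₂ P → Coordinates P (m + n)
coordinates-split {s} {m} {n} {P = P} C₁ C₂ sp = record
  { embed = embed ; embed-xor = embed-xor ; embed-∈ = embed-∈
  ; coords = coords ; coords-embed = coords-embed ; embed-coords = embed-coords }
  where
  module E₁ = Coordinates C₁
  module E₂ = Coordinates C₂
  open Splitting sp

  embed : Vec Bool (m + n) → Tensor (suc s)
  embed c = join (E₁.embed (take m c)) (E₂.embed (drop m c))

  embed-xor : ∀ c c′ → embed (zipWith _xor_ c c′) ≡ embed c +ᵀ embed c′
  embed-xor c c′ = trans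
    (cong₂ join (trans (cong E₁.embed (take-zipWith _xor_ c c′)) (E₁.embed-xor (take m c) (take m c′)))
                (trans (cong E₂.embed (drop-zipWith _xor_ c c′)) (E₂.embed-xor (drop m c) (drop m c′))))
    (join-+ᵀ _ _ _ _)

  embed-∈ : ∀ c → P (embed c)
  embed-∈ c = join-∈ (E₁.embed-∈ (take m c)) (E₂.embed-∈ (drop m c))

  coords : Tensor (suc s) → Vec Bool (m + n)
  coords v = E₁.coords (split₁ v) ++ᵛ E₂.coords (split₂ v)

  coords-embed : ∀ c → coords (embed c) ≡ c
  coords-embed c = trans
    (cong₂ _++ᵛ_ (trans (cong E₁.coords (split₁-join (E₁.embed-∈ _) (E₂.embed-∈ _))) (E₁.coords-embed (take m c)))
                 (trans (cong E₂.coords (split₂-join (E₁.embed-∈ _) (E₂.embed-∈ _))) (E₂.coords-embed (drop m c))))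
    (take++drop≡id m c)

  embed-coords : ∀ {v} → P v → embed (coords v) ≡ v
  embed-coords {v} v∈P with ++-injective (take m (coords v)) (E₁.coords (split₁ v)) (take++drop≡id m (coords v))
  ... | take≡ , drop≡ = begin
    join (E₁.embed (take m (coords v))) (E₂.embed (drop m (coords v)))
      ≡⟨ cong₂ (λ x y → join (E₁.embed x) (E₂.embed y)) take≡ drop≡ ⟩
    join (E₁.embed (E₁.coords (split₁ v))) (E₂.embed (E₂.coords (split₂ v)))
      ≡⟨ cong₂ join (E₁.embed-coords (split₁-∈ v∈P)) (E₂.embed-coords (split₂-∈ v∈P)) ⟩
    join (split₁ v) (split₂ v)
      ≡⟨ join-split v∈P ⟩
    v ∎
    where open ≡-Reasoning

-- InW: the w with T w = w and w + S w + R w = 0, i.e. the values f(X) of the G-maps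
-- f : st → st^⊗s.  InM: the vectors fixed by R.

wGens mGens : List FSum
wGens = 1+T ∷ 1+S+R ∷ []
mGens = 1+R ∷ []

InW InM : ∀ {s} → Tensor s → Set
InW = Annihilated wGens
InM = Annihilated mGens

-- W (s + 1) ≅ M s ⊕ W s and M (s + 1) ≅ W s ⊕ W s.  Each `refl` below checks an identity
-- in F₂[M₂(F₂)] exhibiting an element as a combination of the generators of an ideal.

splittingW : ∀ {s} → Splitting (InM {s}) InW InW
splittingW = record
  { join        = pair 1+T [ I ] [ I ] 1+S
  ; join-+ᵀ     = pair-+ᵀ 1+T [ I ] [ I ] 1+S
  ; join-∈      = λ {z} {w} z∈M w∈W →
      trans (⟦⟧-pair 1+T 1+T [ I ] [ I ] 1+S z w)
            (pair-vanishes (annihilates z∈M [] refl) (annihilates w∈W ([ I ] ∷ [] ∷ []) refl)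
                           (annihilates z∈M [] refl) (annihilates w∈W ([] ∷ [ I ] ∷ []) refl))
    ∷ trans (⟦⟧-pair 1+S+R 1+T [ I ] [ I ] 1+S z w)
            (pair-vanishes (annihilates z∈M (1+T ∷ []) refl) (annihilates w∈W ([] ∷ [ T ] ∷ []) refl)
                           (annihilates z∈M (1+S+R ∷ []) refl) (annihilates w∈W ([ I ] ∷ [] ∷ []) refl))
    ∷ []
  ; split₁      = λ (u , u′) → ⟦ 1+R+R² ⟧ u′
  ; split₂      = λ (u , u′) → ⟦ TN ⟧ u′
  ; split₁-∈    = λ { {u , u′} _ → ⟦⟧-⊛-vanishes 1+R 1+R+R² refl u′ ∷ [] }
  ; split₂-∈    = λ { {u , u′} _ → ⟦⟧-⊛-vanishes 1+T TN refl u′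
                                 ∷ ⟦⟧-⊛-vanishes 1+S+R TN refl u′ ∷ [] }
  ; split₁-join = λ {z} {w} z∈M w∈W →
      trans (⟦⟧-row 1+R+R² [ I ] 1+S z w)
            (sum-with-zeroʳ (fixes z∈M ([ R ] ∷ []) refl) (annihilates w∈W ([] ∷ (S ∷ R ∷ []) ∷ []) refl))
  ; split₂-join = λ {z} {w} z∈M w∈W →
      trans (⟦⟧-row TN [ I ] 1+S z w)
            (sum-with-zeroˡ (annihilates z∈M ((S ∷ R ∷ []) ∷ []) refl) (fixes w∈W ([] ∷ [ T ] ∷ []) refl))
  ; join-split  = λ { {u , u′} v∈W → cong₂ _,_
      (trans (⟦⟧-after 1+T 1+R+R² [ I ] TN u′)
             (sym (Related-[I] (relation v∈W ([] ∷ [ T ] ∷ [] ∷ [] ∷ []) refl refl))))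
      (trans (⟦⟧-after [ I ] 1+R+R² 1+S TN u′)
             (Related-fixes (relation v∈W ([] ∷ [] ∷ [] ∷ 1+T ∷ []) refl refl))) }
  }
  where
  TN : FSum
  TN = 1+T ⊛ (R ∷ R² ∷ [])

splittingM : ∀ {s} → Splitting (InW {s}) InW InM
splittingM = record
  { join        = pair [ R ] [ R *ᴹ S ] [ I ] [ S ]
  ; join-+ᵀ     = pair-+ᵀ [ R ] [ R *ᴹ S ] [ I ] [ S ]
  ; join-∈      = λ {w₁} {w₂} w₁∈W w₂∈W →
      trans (⟦⟧-pair 1+R [ R ] [ R *ᴹ S ] [ I ] [ S ] w₁ w₂)
            (pair-vanishes (annihilates w₁∈W [] refl) (annihilates w₂∈W [] refl)
                           (annihilates w₁∈W ([ S ] ∷ [ I ] ∷ []) refl) (annihilates w₂∈W ([ R ] ∷ [ T ] ∷ []) refl))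
    ∷ []
  ; split₁      = λ (u , u′) → ⟦ TS ⟧ u′
  ; split₂      = λ (u , u′) → ⟦ I ∷ T ∷ [] ⟧ u′
  ; split₁-∈    = λ { {u , u′} v∈M →
        ⟦⟧-⊛-vanishes 1+T TS refl u′
      ∷ trans (sym (⟦⟧-⊛ 1+S+R TS u′))
              (Related-[] (relation v∈M ((S ∷ R ∷ []) ∷ 1+T ∷ []) refl refl))
      ∷ [] }
  ; split₂-∈    = λ { {u , u′} v∈M →
        ⟦⟧-⊛-vanishes 1+T 1+T refl u′
      ∷ trans (sym (⟦⟧-⊛ 1+S+R 1+T u′))
              (Related-[] (relation v∈M ((S ∷ R ∷ []) ∷ 1+T ∷ []) refl refl))
      ∷ [] }
  ; split₁-join = λ {w₁} {w₂} w₁∈W w₂∈W →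
      trans (⟦⟧-row TS [ I ] [ S ] w₁ w₂)
            (sum-with-zeroʳ (fixes w₁∈W ([] ∷ [ I ] ∷ []) refl) (annihilates w₂∈W ([ I ] ∷ [] ∷ []) refl))
  ; split₂-join = λ {w₁} {w₂} w₁∈W w₂∈W →
      trans (⟦⟧-row 1+T [ I ] [ S ] w₁ w₂)
            (sum-with-zeroˡ (annihilates w₁∈W ([ I ] ∷ [] ∷ []) refl) (fixes w₂∈W ([] ∷ [ I ] ∷ []) refl))
  ; join-split  = λ { {u , u′} v∈M → cong₂ _,_
      (trans (⟦⟧-after [ R ] TS [ R *ᴹ S ] 1+T u′)
             (sym (Related-[I] (relation v∈M (1+R ∷ [ I ] ∷ []) refl refl))))
      (trans (⟦⟧-after [ I ] TS [ S ] 1+T u′)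
             (Related-fixes (relation v∈M ([ R ] ∷ [ I ] ∷ []) refl refl))) }
  }
  where
  TS : FSum
  TS = 1+T ⊛ [ S ]

splittingTensor : ∀ {s} → Splitting {s} (λ _ → ⊤) (λ _ → ⊤) (λ _ → ⊤)
splittingTensor = record
  { join        = _,_
  ; join-+ᵀ     = λ _ _ _ _ → refl
  ; join-∈      = λ _ _ → tt
  ; split₁      = proj₁
  ; split₂      = proj₂
  ; split₁-∈    = λ _ → tt
  ; split₂-∈    = λ _ → tt
  ; split₁-join = λ _ _ → refl
  ; split₂-join = λ _ _ → refl
  ; join-split  = λ _ → refl
  }

dimTensor dimW dimM : ℕ → ℕ
dimTensor zero    = 1
dimTensor (suc s) = dimTensor s + dimTensor s
dimW zero    = 0
dimW (suc s) = dimM s + dimW s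
dimM zero    = 1
dimM (suc s) = dimW s + dimW s

coordinates₀ : Coordinates {0} (λ _ → ⊤) 1
coordinates₀ = record
  { embed = λ { (x ∷ []) → x } ; embed-xor = λ { (x ∷ []) (y ∷ []) → refl } ; embed-∈ = λ _ → tt
  ; coords = _∷ [] ; coords-embed = λ { (x ∷ []) → refl } ; embed-coords = λ _ → refl }

coordinatesTensor : ∀ s → Coordinates {s} (λ _ → ⊤) (dimTensor s)
coordinatesTensor zero    = coordinates₀
coordinatesTensor (suc s) = coordinates-split (coordinatesTensor s) (coordinatesTensor s) splittingTensor

opaque
  unfolding ⟦_⟧

  W₀-zero : InW {0} false
  W₀-zero = refl ∷ refl ∷ []

  W₀-trivial : ∀ {w} → InW {0} w → false ≡ w
  W₀-trivial {false} _             = refl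
  W₀-trivial {true}  (_ ∷ () ∷ [])

  M₀-everything : ∀ (x : Tensor 0) → ⟦ I ∷ R ∷ [] ⟧ x ≡ 0ᵀ
  M₀-everything false = refl
  M₀-everything true  = refl

coordinatesW : ∀ s → Coordinates (InW {s}) (dimW s)
coordinatesM : ∀ s → Coordinates (InM {s}) (dimM s)

coordinatesW zero = record
  { embed = λ _ → false ; embed-xor = λ { [] [] → refl } ; embed-∈ = λ _ → W₀-zero
  ; coords = λ _ → [] ; coords-embed = λ { [] → refl } ; embed-coords = W₀-trivial }
coordinatesW (suc s) = coordinates-split (coordinatesM s) (coordinatesW s) splittingW

coordinatesM zero = record
  { embed = Coordinates.embed coordinates₀ ; embed-xor = Coordinates.embed-xor coordinates₀
  ; embed-∈ = λ { (x ∷ []) → M₀-everything x ∷ [] }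
  ; coords = Coordinates.coords coordinates₀ ; coords-embed = Coordinates.coords-embed coordinates₀
  ; embed-coords = λ _ → refl }
coordinatesM (suc s) = coordinates-split (coordinatesW s) (coordinatesW s) splittingM

data Bin : Set where
  end   : Bin
  2*_   : Bin → Bin
  1+2*_ : Bin → Bin

value : Bin → ℕ
value end      = 0
value (2* x)   = value x + value x
value (1+2* x) = suc (value x + value x)

weight : Bin → ℕ
weight end      = 0
weight (2* x)   = weight x
weight (1+2* x) = suc (weight x)

increment : Bin → Bin
increment end      = 1+2* end
increment (2* x)   = 1+2* x
increment (1+2* x) = 2* increment x

value-increment : ∀ x → value (increment x) ≡ suc (value x)
value-increment end      = refl
value-increment (2* x)   = refl
value-increment (1+2* x) rewrite value-increment x = cong suc (+-suc (value x) (value x))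

binary : ℕ → Bin
binary zero    = end
binary (suc n) = increment (binary n)

value-binary : ∀ n → value (binary n) ≡ n
value-binary zero    = refl
value-binary (suc n) = trans (value-increment (binary n)) (cong suc (value-binary n))

-- Steinberg's tensor product theorem for L̄_k: writing k = 2k′ or 2k′ + 1,
-- L̄_2k′ is the Frobenius twist of L̄_k′ and L̄_(2k′+1) ≅ L̄_2k′ ⊗ st, so
-- L̄_k ≅ st^⊗(weight k).  Φ realises this isomorphism on coefficients.

-- f(X², Y²) Y + g(X², Y²) X: multiplying by Y leaves the X-exponents unchanged.
interleave : Seq → Seq → Seq
interleave f g m = frob f m xor mulX (frob g) m

mulX-frob-even : ∀ g j → mulX (frob g) (j + j) ≡ false
mulX-frob-even g zero    = refl
mulX-frob-even g (suc j) rewrite +-suc j j = frob-odd g j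

interleave-even : ∀ f g j → interleave f g (j + j) ≡ f j
interleave-even f g j = trans (cong₂ _xor_ (frob-even f j) (mulX-frob-even g j)) (xor-identityʳ (f j))

interleave-odd : ∀ f g j → interleave f g (suc (j + j)) ≡ g j
interleave-odd f g j = trans (cong (_xor frob g (j + j)) (frob-odd f j)) (frob-even g j)

interleave-cong : ∀ {f f′ g g′} → f ≗ f′ → g ≗ g′ → interleave f g ≗ interleave f′ g′
interleave-cong f≗f′ g≗g′ m = cong₂ _xor_ (frob-cong f≗f′ m) (mulX-cong (frob-cong g≗g′) m)

interleave-lin : ∀ α β f f′ g g′ →
  interleave (λ m → (α ∧ f m) xor (β ∧ f′ m)) (λ m → (α ∧ g m) xor (β ∧ g′ m)) ≗
  λ m → (α ∧ interleave f g m) xor (β ∧ interleave f′ g′ m)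
interleave-lin α β f f′ g g′ m = begin
  interleave (λ m → (α ∧ f m) xor (β ∧ f′ m)) (λ m → (α ∧ g m) xor (β ∧ g′ m)) m
    ≡⟨ cong₂ _xor_ (frob-lin α β f f′ m)
                   (trans (mulX-cong (frob-lin α β g g′) m) (mulX-lin α β (frob g) (frob g′) m)) ⟩
  ((α ∧ frob f m) xor (β ∧ frob f′ m)) xor ((α ∧ mulX (frob g) m) xor (β ∧ mulX (frob g′) m))
    ≡⟨ xor-interchange (α ∧ frob f m) (β ∧ frob f′ m) (α ∧ mulX (frob g) m) (β ∧ mulX (frob g′) m) ⟩
  ((α ∧ frob f m) xor (α ∧ mulX (frob g) m)) xor ((β ∧ frob f′ m) xor (β ∧ mulX (frob g′) m))
    ≡⟨ cong₂ _xor_ (∧-distribˡ-xor α (frob f m) (mulX (frob g) m)) (∧-distribˡ-xor β (frob f′ m) (mulX (frob g′) m)) ⟨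
  (α ∧ interleave f g m) xor (β ∧ interleave f′ g′ m) ∎
  where open ≡-Reasoning

Φ : (x : Bin) → Tensor (weight x) → Seq
Φ end      v        m = v ∧ one m
Φ (2* x)   v          = frob (Φ x v)
Φ (1+2* x) (u , u′)   = interleave (Φ x u) (Φ x u′)

Φ-lin : ∀ x α β (v v′ : Tensor (weight x)) → Φ x (α ·ᵀ v +ᵀ β ·ᵀ v′) ≗ λ m → (α ∧ Φ x v m) xor (β ∧ Φ x v′ m)
Φ-lin end      α β v v′ m =
  trans (∧-distribʳ-xor (one m) (α ∧ v) (β ∧ v′)) (cong₂ _xor_ (∧-assoc α v (one m)) (∧-assoc β v′ (one m)))
Φ-lin (2* x)   α β v v′ m = trans (frob-cong (Φ-lin x α β v v′) m) (frob-lin α β (Φ x v) (Φ x v′) m)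
Φ-lin (1+2* x) α β (u , u′) (v , v′) m =
  trans (interleave-cong (Φ-lin x α β u v) (Φ-lin x α β u′ v′) m)
        (interleave-lin α β (Φ x u) (Φ x v) (Φ x u′) (Φ x v′) m)

Φ-+ᵀ : ∀ x (v v′ : Tensor (weight x)) → Φ x (v +ᵀ v′) ≗ λ m → Φ x v m xor Φ x v′ m
Φ-+ᵀ x v v′ m =
  trans (cong (λ w → Φ x w m) (sym (cong₂ _+ᵀ_ (·ᵀ-identityˡ v) (·ᵀ-identityˡ v′)))) (Φ-lin x true true v v′ m)

Φ-·ᵀ : ∀ x β (v : Tensor (weight x)) → Φ x (β ·ᵀ v) ≗ λ m → β ∧ Φ x v m
Φ-·ᵀ x β v m = trans (cong (λ w → Φ x w m) (sym (trans (cong (β ·ᵀ v +ᵀ_) (·ᵀ-zeroˡ v)) (+ᵀ-identityʳ _))))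
                      (trans (Φ-lin x β false v v m) (xor-identityʳ _))

Φ-0ᵀ : ∀ x → Φ x 0ᵀ ≗ λ _ → false
Φ-0ᵀ x m = trans (cong (λ w → Φ x w m) (sym (·ᵀ-zeroˡ 0ᵀ))) (Φ-·ᵀ x false 0ᵀ m)

Φ-comb : ∀ x α β (v v′ : Tensor (weight x)) → Φ x (comb α β v v′) ≗ λ m → (α ∧ Φ x v m) xor (β ∧ Φ x v′ m)
Φ-comb x α β v v′ m = trans (cong (λ w → Φ x w m) (comb-lin α β v v′)) (Φ-lin x α β v v′ m)

substXY-Φ : ∀ x g (v : Tensor (weight x)) →
  substXY (value x) (linForm (a g) (c g)) (linForm (b g) (d g)) (Φ x v) ≗ Φ x (ρ g v)
substXY-Φ end      g v m =
  trans (substXY-degree0 (linForm (a g) (c g)) (linForm (b g) (d g)) (Φ end v) m) (cong (_∧ one m) (∧-identityʳ v))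
substXY-Φ (2* x)   g v m =
  trans (substXY-frob (value x) (a g) (c g) (b g) (d g) (Φ x v) m) (frob-cong (substXY-Φ x g v) m)
substXY-Φ (1+2* x) g (u , u′) m = begin
  substXY (suc (k + k)) A B (interleave (Φ x u) (Φ x u′)) m
    ≡⟨ substXY-xor (suc (k + k)) A B (frob (Φ x u)) (mulX (frob (Φ x u′))) m ⟩
  substXY (suc (k + k)) A B (frob (Φ x u)) m xor substXY (suc (k + k)) A B (mulX (frob (Φ x u′))) m
    ≡⟨ cong₂ _xor_ (substXY-mulY (k + k) A B (frob (Φ x u)) (frob-odd (Φ x u) k) m)
                   (substXY-mulX (k + k) A B (frob (Φ x u′)) m) ⟩
  conv B (substXY (k + k) A B (frob (Φ x u))) m xor conv A (substXY (k + k) A B (frob (Φ x u′))) m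
    ≡⟨ cong₂ _xor_ (conv-cong {f = B} (λ _ → refl) (twisted u) m) (conv-cong {f = A} (λ _ → refl) (twisted u′) m) ⟩
  conv B F m xor conv A F′ m
    ≡⟨ cong₂ _xor_ (conv-linForm (b g) (d g) F m) (conv-linForm (a g) (c g) F′ m) ⟩
  ((d g ∧ F m) xor (b g ∧ mulX F m)) xor ((c g ∧ F′ m) xor (a g ∧ mulX F′ m))
    ≡⟨ xor-interchange (d g ∧ F m) (b g ∧ mulX F m) (c g ∧ F′ m) (a g ∧ mulX F′ m) ⟩
  ((d g ∧ F m) xor (c g ∧ F′ m)) xor ((b g ∧ mulX F m) xor (a g ∧ mulX F′ m))
    ≡⟨ cong₂ _xor_ (frob-Φ-comb (d g) (c g) m)
                   (trans (mulX-cong (frob-Φ-comb (b g) (a g)) m) (mulX-lin (b g) (a g) F F′ m)) ⟨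
  Φ (1+2* x) (ρ g (u , u′)) m ∎
  where
  open ≡-Reasoning
  k : ℕ
  k = value x
  A B F F′ : Seq
  A  = linForm (a g) (c g)
  B  = linForm (b g) (d g)
  F  = frob (Φ x (ρ g u))
  F′ = frob (Φ x (ρ g u′))
  frob-Φ-comb : ∀ α β → frob (Φ x (comb α β (ρ g u) (ρ g u′))) ≗ λ n → (α ∧ F n) xor (β ∧ F′ n)
  frob-Φ-comb α β n =
    trans (frob-cong (Φ-comb x α β (ρ g u) (ρ g u′)) n) (frob-lin α β (Φ x (ρ g u)) (Φ x (ρ g u′)) n)
  twisted : ∀ w → substXY (k + k) A B (frob (Φ x w)) ≗ frob (Φ x (ρ g w))
  twisted w n = trans (substXY-frob k (a g) (c g) (b g) (d g) (Φ x w) n) (frob-cong (substXY-Φ x g w) n)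

evens odds : Seq → Seq
evens f j = f (j + j)
odds  f j = f (suc (j + j))

ψ : (x : Bin) → Seq → Tensor (weight x)
ψ end      P = P 0
ψ (2* x)   P = ψ x (evens P)
ψ (1+2* x) P = ψ x (evens P) , ψ x (odds P)

ψ-cong : ∀ x {P Q : Seq} → (∀ i → i ≤ value x → P i ≡ Q i) → ψ x P ≡ ψ x Q
ψ-cong end      P≡Q = P≡Q 0 z≤n
ψ-cong (2* x)   P≡Q = ψ-cong x (λ j j≤ → P≡Q (j + j) (+-mono-≤ j≤ j≤))
ψ-cong (1+2* x) P≡Q = cong₂ _,_ (ψ-cong x (λ j j≤ → P≡Q (j + j) (m≤n⇒m≤1+n (+-mono-≤ j≤ j≤))))
                                (ψ-cong x (λ j j≤ → P≡Q (suc (j + j)) (s≤s (+-mono-≤ j≤ j≤))))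

ψ-Φ : ∀ x (v : Tensor (weight x)) → ψ x (Φ x v) ≡ v
ψ-Φ end      v        = ∧-identityʳ v
ψ-Φ (2* x)   v        = trans (ψ-cong x (λ j _ → frob-even (Φ x v) j)) (ψ-Φ x v)
ψ-Φ (1+2* x) (u , u′) = cong₂ _,_ (trans (ψ-cong x (λ j _ → interleave-even (Φ x u) (Φ x u′) j)) (ψ-Φ x u))
                                  (trans (ψ-cong x (λ j _ → interleave-odd (Φ x u) (Φ x u′) j)) (ψ-Φ x u′))

ones : ∀ {s} → Tensor s
ones {zero}  = true
ones {suc s} = ones , ones

-- Φ x ones has the largest support, so it cuts out the image of Φ.
Φ-ψ : ∀ x (P : Seq) → (∀ i → Φ x ones i ≡ false → P i ≡ false) → Φ x (ψ x P) ≗ P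
Φ-ψ end      P P⊆ zero    = ∧-identityʳ (P 0)
Φ-ψ end      P P⊆ (suc i) = trans (∧-zeroʳ (P 0)) (sym (P⊆ (suc i) refl))
Φ-ψ (2* x)   P P⊆ i with half i
... | j , inj₁ refl =
  trans (frob-even (Φ x (ψ x (evens P))) j)
        (Φ-ψ x (evens P) (λ l e → P⊆ (l + l) (trans (frob-even (Φ x ones) l) e)) j)
... | j , inj₂ refl =
  trans (frob-odd (Φ x (ψ x (evens P))) j) (sym (P⊆ (suc (j + j)) (frob-odd (Φ x ones) j)))
Φ-ψ (1+2* x) P P⊆ i with half i
... | j , inj₁ refl =
  trans (interleave-even (Φ x (ψ x (evens P))) (Φ x (ψ x (odds P))) j)
        (Φ-ψ x (evens P) (λ l e → P⊆ (l + l) (trans (interleave-even (Φ x ones) (Φ x ones) l) e)) j)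
... | j , inj₂ refl =
  trans (interleave-odd (Φ x (ψ x (evens P))) (Φ x (ψ x (odds P))) j)
        (Φ-ψ x (odds P) (λ l e → P⊆ (suc (l + l)) (trans (interleave-odd (Φ x ones) (Φ x ones) l) e)) j)

Φ-support : ∀ x (v : Tensor (weight x)) i → Φ x ones i ≡ false → Φ x v i ≡ false
Φ-support end      v        i h = trans (cong (v ∧_) h) (∧-zeroʳ v)
Φ-support (2* x)   v        i h = frob-support (Φ x ones) (Φ x v) (Φ-support x v) i h
Φ-support (1+2* x) (u , u′) i h with half i
... | j , inj₁ refl = trans (interleave-even (Φ x u) (Φ x u′) j)
                            (Φ-support x u j (trans (sym (interleave-even (Φ x ones) (Φ x ones) j)) h))
... | j , inj₂ refl = trans (interleave-odd (Φ x u) (Φ x u′) j)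
                            (Φ-support x u′ j (trans (sym (interleave-odd (Φ x ones) (Φ x ones) j)) h))

Φ-ones : ∀ x → Φ x ones ≗ pow (linForm true true) (value x)
Φ-ones end      m = refl
Φ-ones (2* x)   m = trans (frob-cong (Φ-ones x) m) (sym (pow-linForm-double true true (value x) m))
Φ-ones (1+2* x) m = begin
  frob (Φ x ones) m xor mulX (frob (Φ x ones)) m
    ≡⟨ cong₂ _xor_ (frob-cong (Φ-ones x) m) (mulX-cong (frob-cong (Φ-ones x)) m) ⟩
  frob (pow ℓ k) m xor mulX (frob (pow ℓ k)) m
    ≡⟨ cong₂ _xor_ (pow-linForm-double true true k m) (mulX-cong (pow-linForm-double true true k) m) ⟨
  pow ℓ (k + k) m xor mulX (pow ℓ (k + k)) m
    ≡⟨ conv-linForm true true (pow ℓ (k + k)) m ⟨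
  pow ℓ (suc (k + k)) m ∎
  where
  open ≡-Reasoning
  k : ℕ
  k = value x
  ℓ : Seq
  ℓ = linForm true true

isOdd : ℕ → Bool
isOdd zero    = false
isOdd (suc n) = not (isOdd n)

isOdd-+ : ∀ m n → isOdd (m + n) ≡ isOdd m xor isOdd n
isOdd-+ zero    n = refl
isOdd-+ (suc m) n = trans (cong not (isOdd-+ m n)) (not-distribˡ-xor (isOdd m) (isOdd n))

isOdd-C : ∀ k i → isOdd (k C i) ≡ pow (linForm true true) k i
isOdd-C zero    zero    = refl
isOdd-C zero    (suc i) = refl
isOdd-C (suc k) zero    = isOdd-C k zero
isOdd-C (suc k) (suc i) = begin
  isOdd (suc k C suc i)                          ≡⟨ cong isOdd (nCk+nC[k+1]≡[n+1]C[k+1] k i) ⟨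
  isOdd (k C i + k C suc i)                      ≡⟨ isOdd-+ (k C i) (k C suc i) ⟩
  isOdd (k C i) xor isOdd (k C suc i)            ≡⟨ cong₂ _xor_ (isOdd-C k i) (isOdd-C k (suc i)) ⟩
  pow ℓ k i xor pow ℓ k (suc i)                  ≡⟨ xor-comm (pow ℓ k i) (pow ℓ k (suc i)) ⟩
  pow ℓ k (suc i) xor pow ℓ k i                  ≡⟨ conv-linForm true true (pow ℓ k) (suc i) ⟨
  pow ℓ (suc k) (suc i)                          ∎
  where
  open ≡-Reasoning
  ℓ : Seq
  ℓ = linForm true true

isOdd-%2 : ∀ n → n % 2 ≡ (if isOdd n then 1 else 0)
isOdd-%2 zero          = refl
isOdd-%2 (suc zero)    = refl
isOdd-%2 (suc (suc n)) =
  trans (cong (_% 2) (+-comm 2 n))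
        (trans ([m+n]%n≡m%n n 2)
               (trans (isOdd-%2 n) (cong (λ b → if b then 1 else 0) (sym (not-involutive (isOdd n))))))

even⇒¬isOdd : ∀ n → n % 2 ≡ 0 → isOdd n ≡ false
even⇒¬isOdd n n%2≡0 with isOdd n | isOdd-%2 n
... | false | _       = refl
... | true  | n%2≡1 with trans (sym n%2≡1) n%2≡0
...   | ()

¬isOdd⇒even : ∀ n → isOdd n ≡ false → n % 2 ≡ 0
¬isOdd⇒even n ¬odd = trans (isOdd-%2 n) (cong (λ b → if b then 1 else 0) ¬odd)

-- Coefficients of vectors, with junk value false out of range

coefficient : ∀ {n} → Vec Bool n → ℕ → Bool
coefficient []       _       = false
coefficient (x ∷ xs) zero    = x
coefficient (x ∷ xs) (suc i) = coefficient xs i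

coefficient-tabulate : ∀ n (f : Seq) i → i < n → coefficient (tabulate {n = n} (λ m → f (toℕ m))) i ≡ f i
coefficient-tabulate (suc n) f zero    _         = refl
coefficient-tabulate (suc n) f (suc i) (s≤s i<n) = coefficient-tabulate n (λ j → f (suc j)) i i<n

coefficient-lookup : ∀ {n} (p : Vec Bool n) (m : Fin n) → coefficient p (toℕ m) ≡ lookup p m
coefficient-lookup (x ∷ p) fzero    = refl
coefficient-lookup (x ∷ p) (fsuc m) = coefficient-lookup p m

-- `act` reads the coefficients of its argument through a lookup local to a
-- `where` clause of its definition; unification gives it a name here.
mutual
  act-coefficient : (k : ℕ) → Mat → Poly k → ℕ → Bool
  act-coefficient = _

  act-unfold : ∀ k g p → act k g p ≡
    tabulate (λ m → substXY k (linForm (a g) (c g)) (linForm (b g) (d g)) (act-coefficient k g p) (toℕ m))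
  act-unfold k g p = refl

act-coefficient-correct : ∀ k g p i → act-coefficient k g p i ≡ coefficient p i
act-coefficient-correct k       g (x ∷ xs) zero    = refl
act-coefficient-correct zero    g (x ∷ []) (suc j) = refl
act-coefficient-correct (suc k) g (x ∷ xs) (suc j) = act-coefficient-correct k g xs j

ι : (x : Bin) → Tensor (weight x) → Poly (value x)
ι x v = tabulate (λ m → Φ x v (toℕ m))

act-ι : ∀ x g (v : Tensor (weight x)) → act (value x) g (ι x v) ≡ ι x (ρ g v)
act-ι x g v = trans (act-unfold (value x) g (ι x v)) (tabulate-cong (λ m →
  trans (substXY-cong (value x) _ _ (λ i i≤k →
           trans (act-coefficient-correct (value x) g (ι x v) i)
                 (coefficient-tabulate (suc (value x)) (Φ x v) i (s≤s i≤k))) (toℕ m))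
        (substXY-Φ x g v (toℕ m))))

zipWith-tabulate : ∀ {n} (f g : Fin n → Bool) → zipWith _xor_ (tabulate f) (tabulate g) ≡ tabulate (λ i → f i xor g i)
zipWith-tabulate f g = trans (sym (tabulate∘lookup (zipWith _xor_ (tabulate f) (tabulate g)))) (tabulate-cong (λ i →
  trans (lookup-zipWith _xor_ i (tabulate f) (tabulate g)) (cong₂ _xor_ (lookup∘tabulate f i) (lookup∘tabulate g i))))

ι-+ᵀ : ∀ x (v v′ : Tensor (weight x)) → ι x (v +ᵀ v′) ≡ ι x v +P ι x v′
ι-+ᵀ x v v′ = trans (tabulate-cong (λ m → Φ-+ᵀ x v v′ (toℕ m)))
                    (sym (zipWith-tabulate (λ m → Φ x v (toℕ m)) (λ m → Φ x v′ (toℕ m))))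

ι-·ᵀ : ∀ x β (v : Tensor (weight x)) → ι x (β ·ᵀ v) ≡ β ·P ι x v
ι-·ᵀ x β v = trans (tabulate-cong (λ m → Φ-·ᵀ x β v (toℕ m))) (tabulate-∘ (β ∧_) (λ m → Φ x v (toℕ m)))

ι-0ᵀ : ∀ x → ι x 0ᵀ ≡ 0P
ι-0ᵀ x = trans (tabulate-cong (λ m → Φ-0ᵀ x (toℕ m)))
               (sym (trans (sym (tabulate∘lookup 0P)) (tabulate-cong lookup-0P)))
  where
  lookup-0P : ∀ (m : Fin (suc (value x))) → lookup (0P {value x}) m ≡ false
  lookup-0P m = Data.Vec.Properties.lookup-replicate m false

InL-ι : ∀ x (v : Tensor (weight x)) → InL (value x) (ι x v)
InL-ι x v i even = trans (lookup∘tabulate (λ m → Φ x v (toℕ m)) i)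
  (Φ-support x v (toℕ i) (trans (Φ-ones x (toℕ i))
    (trans (sym (isOdd-C (value x) (toℕ i))) (even⇒¬isOdd (value x C toℕ i) even))))

read : (x : Bin) → Poly (value x) → Tensor (weight x)
read x p = ψ x (coefficient p)

read-ι : ∀ x (v : Tensor (weight x)) → read x (ι x v) ≡ v
read-ι x v = trans (ψ-cong x (λ i i≤k → coefficient-tabulate (suc (value x)) (Φ x v) i (s≤s i≤k))) (ψ-Φ x v)

ι-injective : ∀ x {v v′ : Tensor (weight x)} → ι x v ≡ ι x v′ → v ≡ v′
ι-injective x {v} {v′} ιv≡ιv′ = trans (sym (read-ι x v)) (trans (cong (read x) ιv≡ιv′) (read-ι x v′))

ι-read : ∀ x (p : Poly (value x)) → InL (value x) p → ι x (read x p) ≡ p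
ι-read x p p∈L = trans (tabulate-cong (λ m → trans (Φ-ψ x (coefficient p) p⊆ (toℕ m)) (coefficient-lookup p m)))
                       (tabulate∘lookup p)
  where
  p⊆ : ∀ i → Φ x ones i ≡ false → coefficient p i ≡ false
  p⊆ i Φi≡0 with i <? suc (value x)
  ... | yes i<n = trans (trans (cong (coefficient p) (sym (toℕ-fromℕ< i<n))) (coefficient-lookup p (fromℕ< i<n)))
                        (p∈L (fromℕ< i<n) (¬isOdd⇒even (value x C j) (trans (isOdd-C (value x) j)
                          (trans (sym (Φ-ones x j)) (trans (cong (Φ x ones) (toℕ-fromℕ< i<n)) Φi≡0)))))
    where j = toℕ (fromℕ< i<n)
  ... | no  i≮n = out-of-range p i (≤-pred (≰⇒> i≮n))
    where
    out-of-range : ∀ {n} (q : Vec Bool n) i → n ≤ i → coefficient q i ≡ false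
    out-of-range []      i       _         = refl
    out-of-range (_ ∷ q) (suc i) (s≤s n≤i) = out-of-range q i n≤i

unit : ∀ {n} → Fin n → Vec Bool n
unit {suc n} fzero    = true ∷ replicate n false
unit {suc n} (fsuc j) = false ∷ unit j

zipWith-self : ∀ {n} (c : Vec Bool n) → zipWith _xor_ c c ≡ replicate n false
zipWith-self c = trans (cong (zipWith _xor_ c) (sym (map-id c))) (zipWith-inverseʳ xor-same c)

Linear : ∀ {n k} → (Vec Bool n → Poly k) → Set
Linear {n} F = ∀ c c′ → F (zipWith _xor_ c c′) ≡ F c +P F c′

linear-zero : ∀ {n k} (F : Vec Bool n → Poly k) → Linear F → F (replicate n false) ≡ 0P
linear-zero {n} F F-lin = begin
  F 0ᵛ                ≡⟨ cong F (zipWith-self 0ᵛ) ⟨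
  F (zipWith _xor_ 0ᵛ 0ᵛ) ≡⟨ F-lin 0ᵛ 0ᵛ ⟩
  F 0ᵛ +P F 0ᵛ        ≡⟨ zipWith-self (F 0ᵛ) ⟩
  0P                  ∎
  where
  open ≡-Reasoning
  0ᵛ : Vec Bool n
  0ᵛ = replicate n false

lincomb-unit : ∀ {k} n (F : Vec Bool n → Poly k) → Linear F → ∀ λs →
  lincomb _+P_ _·P_ 0P n λs (λ j → F (unit j)) ≡ F (tabulate λs)
lincomb-unit zero    F F-lin λs = sym (linear-zero F F-lin)
lincomb-unit (suc n) F F-lin λs = begin
  (λ₀ ·P F e₀) +P lincomb _+P_ _·P_ 0P n λs′ (λ j → F (false ∷ unit j))
    ≡⟨ cong₂ _+P_ (scaled λ₀) (lincomb-unit n F′ F′-lin λs′) ⟩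
  F (λ₀ ∷ replicate n false) +P F (false ∷ tabulate λs′)
    ≡⟨ F-lin (λ₀ ∷ replicate n false) (false ∷ tabulate λs′) ⟨
  F ((λ₀ xor false) ∷ zipWith _xor_ (replicate n false) (tabulate λs′))
    ≡⟨ cong₂ (λ x c → F (x ∷ c)) (xor-identityʳ λ₀) (zipWith-identityˡ xor-identityˡ (tabulate λs′)) ⟩
  F (λ₀ ∷ tabulate λs′) ∎
  where
  open ≡-Reasoning
  λ₀ : Bool
  λ₀ = λs fzero
  λs′ : Fin n → Bool
  λs′ j = λs (fsuc j)
  e₀ : Vec Bool (suc n)
  e₀ = true ∷ replicate n false
  F′ : Vec Bool n → Poly _
  F′ c = F (false ∷ c)
  F′-lin : Linear F′
  F′-lin c c′ = F-lin (false ∷ c) (false ∷ c′)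
  scaled : ∀ β → β ·P F e₀ ≡ F (β ∷ replicate n false)
  scaled true  = map-id (F e₀)
  scaled false = trans (map-const (F e₀) false) (sym (linear-zero F F-lin))

tabulate-false : ∀ {n} (λs : Fin n → Bool) → tabulate λs ≡ replicate n false → ∀ j → λs j ≡ false
tabulate-false λs λs≡0 j =
  trans (sym (lookup∘tabulate λs j)) (trans (cong (λ c → lookup c j) λs≡0) (lookup-replicate j false))

hasDim-Poly : ∀ {k n} (S : Poly k → Set) (F : Vec Bool n → Poly k) → Linear F → (∀ c → S (F c)) →
  (∀ c → F c ≡ 0P → c ≡ replicate n false) → (∀ p → S p → Σ (Vec Bool n) (λ c → p ≡ F c)) →
  HasDim (Poly k) _≡_ _+P_ _·P_ 0P S n
hasDim-Poly {n = n} S F F-lin F-∈ F-injective F-onto =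
  (λ j → F (unit j)) , (λ j → F-∈ (unit j)) , independent , spanning
  where
  independent : ∀ λs → lincomb _+P_ _·P_ 0P n λs (λ j → F (unit j)) ≡ 0P → ∀ j → λs j ≡ false
  independent λs sum≡0 = tabulate-false λs (F-injective (tabulate λs) (trans (sym (lincomb-unit n F F-lin λs)) sum≡0))
  spanning : ∀ p → S p → Σ (Fin n → Bool) (λ λs → p ≡ lincomb _+P_ _·P_ 0P n λs (λ j → F (unit j)))
  spanning p p∈S with F-onto p p∈S
  ... | c , p≡Fc =
    lookup c , trans p≡Fc (trans (cong F (sym (tabulate∘lookup c))) (sym (lincomb-unit n F F-lin (lookup c))))

lincomb-at : ∀ {k} n λs (fs : Fin n → Map k) u →
  lincomb _+M_ _·M_ 0M n λs fs u ≡ lincomb _+P_ _·P_ 0P n λs (λ j → fs j u)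
lincomb-at zero    λs fs u = refl
lincomb-at (suc n) λs fs u =
  cong ((λs fzero ·P fs fzero u) +P_) (lincomb-at n (λ j → λs (fsuc j)) (λ j → fs (fsuc j)) u)

hasDim-Map : ∀ {k n} (S : Map k → Set) (F : Vec Bool n → Map k) → (∀ u → Linear (λ c → F c u)) → (∀ c → S (F c)) →
  (∀ c → F c ≈M 0M → c ≡ replicate n false) → (∀ f → S f → Σ (Vec Bool n) (λ c → f ≈M F c)) →
  HasDim (Map k) _≈M_ _+M_ _·M_ 0M S n
hasDim-Map {n = n} S F F-lin F-∈ F-injective F-onto =
  (λ j → F (unit j)) , (λ j → F-∈ (unit j)) , independent , spanning
  where
  at : ∀ λs u → lincomb _+M_ _·M_ 0M n λs (λ j → F (unit j)) u ≡ F (tabulate λs) u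
  at λs u = trans (lincomb-at n λs _ u) (lincomb-unit n (λ c → F c u) (F-lin u) λs)
  independent : ∀ λs → lincomb _+M_ _·M_ 0M n λs (λ j → F (unit j)) ≈M 0M → ∀ j → λs j ≡ false
  independent λs sum≈0 =
    tabulate-false λs (F-injective (tabulate λs) (λ u u∈st → trans (sym (at λs u)) (sum≈0 u u∈st)))
  spanning : ∀ f → S f → Σ (Fin n → Bool) (λ λs → f ≈M lincomb _+M_ _·M_ 0M n λs (λ j → F (unit j)))
  spanning f f∈S with F-onto f f∈S
  ... | c , f≈Fc = lookup c , λ u u∈st →
    trans (f≈Fc u u∈st) (trans (cong (λ c → F c u) (sym (tabulate∘lookup c))) (sym (at (lookup c) u)))

embed-zero : ∀ {s n} {P : Tensor s → Set} (𝒞 : Coordinates P n) → Coordinates.embed 𝒞 (replicate n false) ≡ 0ᵀ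
embed-zero {n = n} 𝒞 = begin
  embed 0ᵛ                            ≡⟨ cong embed (zipWith-self 0ᵛ) ⟨
  embed (zipWith _xor_ 0ᵛ 0ᵛ)         ≡⟨ embed-xor 0ᵛ 0ᵛ ⟩
  embed 0ᵛ +ᵀ embed 0ᵛ                ≡⟨ +ᵀ-self (embed 0ᵛ) ⟩
  0ᵀ                                  ∎
  where
  open ≡-Reasoning
  open Coordinates 𝒞
  0ᵛ : Vec Bool n
  0ᵛ = replicate n false

embed-injective : ∀ {s n} {P : Tensor s → Set} (𝒞 : Coordinates P n) → ∀ c →
  Coordinates.embed 𝒞 c ≡ 0ᵀ → c ≡ replicate n false
embed-injective {n = n} 𝒞 c ec≡0 =
  trans (sym (coords-embed c))
        (trans (cong coords (trans ec≡0 (sym (embed-zero 𝒞)))) (coords-embed (replicate n false)))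
  where open Coordinates 𝒞

dimL-binary : ∀ x → DimL (value x) (dimTensor (weight x))
dimL-binary x = hasDim-Poly (InL (value x)) (λ c → ι x (embed c)) lin (λ c → InL-ι x (embed c)) injective onto
  where
  open Coordinates (coordinatesTensor (weight x))
  lin : Linear (λ c → ι x (embed c))
  lin c c′ = trans (cong (ι x) (embed-xor c c′)) (ι-+ᵀ x (embed c) (embed c′))
  injective : ∀ c → ι x (embed c) ≡ 0P → c ≡ replicate _ false
  injective c ιc≡0 = embed-injective (coordinatesTensor (weight x)) c (ι-injective x (trans ιc≡0 (sym (ι-0ᵀ x))))
  onto : ∀ p → InL (value x) p → Σ (Vec Bool _) (λ c → p ≡ ι x (embed c))
  onto p p∈L = coords (read x p) , sym (trans (cong (ι x) (embed-coords tt)) (ι-read x p p∈L))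

-- Hom_G(st, L̄_k) ≅ W (weight k)

-- u ∈ Poly 1 lists the coefficients of Y and of X.
homOf : (x : Bin) → Tensor (weight x) → Map (value x)
homOf x w (u₀ ∷ u₁ ∷ []) = ι x (comb u₀ u₁ (ρ S w) w)

Γ : Bool → Bool → FSum
Γ γ α = (if γ then [ S ] else []) ++ (if α then [ I ] else [])

⟦Γ⟧ : ∀ {s} γ α (w : Tensor s) → ⟦ Γ γ α ⟧ w ≡ comb γ α (ρ S w) w
⟦Γ⟧ true  true  w = trans (⟦⟧-∷ S [ I ] w) (cong (ρ S w +ᵀ_) (⟦[I]⟧ w))
⟦Γ⟧ true  false w = ⟦[ S ]⟧ w
⟦Γ⟧ false true  w = ⟦[I]⟧ w
⟦Γ⟧ false false w = ⟦⟧-[] w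

-- With w = f(X) and S w = f(Y), this says f(g Y) = g f(Y) and f(g X) = g f(X).
ActsOnW : ∀ {s} → Tensor s → Mat → Set
ActsOnW w g = (ρ g (ρ S w) ≡ comb (d g) (b g) (ρ S w) w) × (ρ g w ≡ comb (c g) (a g) (ρ S w) w)

acts-by : ∀ {s} {w : Tensor s} → InW w → ∀ g κs κs′ →
  [ g *ᴹ S ] ++ Γ (d g) (b g) ≈ combination κs wGens → [ g ] ++ Γ (c g) (a g) ≈ combination κs′ wGens →
  ActsOnW w g
acts-by {w = w} w∈W g κs κs′ onY onX =
    trans (sym (trans (⟦[ g *ᴹ S ]⟧ w) (ρ-*ᴹ g S w))) (trans (agree w∈W κs onY) (⟦Γ⟧ (d g) (b g) w))
  , trans (sym (⟦[ g ]⟧ w)) (trans (agree w∈W κs′ onX) (⟦Γ⟧ (c g) (a g) w))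

W-equivariant : ∀ {s} {w : Tensor s} → InW w → ∀ g → InSL2 g → ActsOnW w g
W-equivariant w∈W g@(mat true  false false true ) _ = acts-by w∈W g ([] ∷ [] ∷ []) ([] ∷ [] ∷ []) refl refl
W-equivariant w∈W g@(mat false true  true  false) _ = acts-by w∈W g ([] ∷ [] ∷ []) ([] ∷ [] ∷ []) refl refl
W-equivariant w∈W g@(mat true  true  false true ) _ = acts-by w∈W g ([] ∷ [ I ] ∷ []) ([ I ] ∷ [] ∷ []) refl refl
W-equivariant w∈W g@(mat true  true  true  false) _ = acts-by w∈W g ([ I ] ∷ [] ∷ []) ([] ∷ [ I ] ∷ []) refl refl
W-equivariant w∈W g@(mat false true  true  true ) _ = acts-by w∈W g ([] ∷ [ S ] ∷ []) ([ S ] ∷ [] ∷ []) refl refl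
W-equivariant w∈W g@(mat true  false true  true ) _ = acts-by w∈W g ([ S ] ∷ [] ∷ []) ([] ∷ [ S ] ∷ []) refl refl
W-equivariant w∈W (mat true  true  true  true ) ()
W-equivariant w∈W (mat true  true  false false) ()
W-equivariant w∈W (mat true  false true  false) ()
W-equivariant w∈W (mat true  false false false) ()
W-equivariant w∈W (mat false true  false true ) ()
W-equivariant w∈W (mat false true  false false) ()
W-equivariant w∈W (mat false false true  true ) ()
W-equivariant w∈W (mat false false true  false) ()
W-equivariant w∈W (mat false false false true ) ()
W-equivariant w∈W (mat false false false false) ()

comb₀ : ∀ α β (p q : Bool) → comb {0} α β p q ≡ (p ∧ α) xor (q ∧ β)
comb₀ α β p q = trans (comb-lin α β p q) (cong₂ _xor_ (∧-comm α p) (∧-comm β q))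

act₁ : ∀ g u₀ u₁ → act 1 g (u₀ ∷ u₁ ∷ []) ≡ comb (d g) (c g) u₀ u₁ ∷ comb (b g) (a g) u₀ u₁ ∷ []
act₁ g u₀ u₁ = begin
  act 1 g (u₀ ∷ u₁ ∷ [])                  ≡⟨ cong (act 1 g) (ι-degree1 u₀ u₁) ⟨
  act 1 g (ι (1+2* end) (u₀ , u₁))        ≡⟨ act-ι (1+2* end) g (u₀ , u₁) ⟩
  ι (1+2* end) (ρ g (u₀ , u₁))            ≡⟨ ι-degree1 _ _ ⟩
  comb (d g) (c g) u₀ u₁ ∷ comb (b g) (a g) u₀ u₁ ∷ [] ∎
  where
  open ≡-Reasoning
  ι-degree1 : ∀ u₀ u₁ → ι (1+2* end) (u₀ , u₁) ≡ u₀ ∷ u₁ ∷ []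
  ι-degree1 u₀ u₁ = cong₂ _∷_ (trans (xor-identityʳ (u₀ ∧ true)) (∧-identityʳ u₀)) (cong (_∷ []) (∧-identityʳ u₁))

homOf-isGHom : ∀ x {w : Tensor (weight x)} → InW w → IsGHom (value x) (homOf x w)
homOf-isGHom x {w} w∈W = ∈L , additive , homogeneous , equivariant
  where
  ∈L : ∀ u → InSt u → InL (value x) (homOf x w u)
  ∈L (u₀ ∷ u₁ ∷ []) _ = InL-ι x _
  additive : ∀ u v → InSt u → InSt v → homOf x w (u +P v) ≡ homOf x w u +P homOf x w v
  additive (u₀ ∷ u₁ ∷ []) (v₀ ∷ v₁ ∷ []) _ _ =
    trans (cong (ι x) (comb-xor u₀ v₀ u₁ v₁ (ρ S w) w)) (ι-+ᵀ x _ _)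
  homogeneous : ∀ β u → InSt u → homOf x w (β ·P u) ≡ β ·P homOf x w u
  homogeneous β (u₀ ∷ u₁ ∷ []) _ = trans (cong (ι x) (comb-∧ β u₀ u₁ (ρ S w) w)) (ι-·ᵀ x β _)
  equivariant : ∀ g → InSL2 g → ∀ u → InSt u → homOf x w (act 1 g u) ≡ act (value x) g (homOf x w u)
  equivariant g g∈SL₂ (u₀ ∷ u₁ ∷ []) _ = begin
    homOf x w (act 1 g (u₀ ∷ u₁ ∷ []))
      ≡⟨ cong (homOf x w) (act₁ g u₀ u₁) ⟩
    ι x (comb (comb (d g) (c g) u₀ u₁) (comb (b g) (a g) u₀ u₁) (ρ S w) w)
      ≡⟨ cong₂ (λ α β → ι x (comb α β (ρ S w) w)) (comb₀ (d g) (c g) u₀ u₁) (comb₀ (b g) (a g) u₀ u₁) ⟩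
    ι x (comb ((u₀ ∧ d g) xor (u₁ ∧ c g)) ((u₀ ∧ b g) xor (u₁ ∧ a g)) (ρ S w) w)
      ≡⟨ cong (ι x) (comb-comb u₀ u₁ (d g) (b g) (c g) (a g) (ρ S w) w) ⟨
    ι x (comb u₀ u₁ (comb (d g) (b g) (ρ S w) w) (comb (c g) (a g) (ρ S w) w))
      ≡⟨ cong (ι x) (cong₂ (comb u₀ u₁) (proj₁ (W-equivariant w∈W g g∈SL₂)) (proj₂ (W-equivariant w∈W g g∈SL₂))) ⟨
    ι x (comb u₀ u₁ (ρ g (ρ S w)) (ρ g w))
      ≡⟨ cong (ι x) (ρ-comb g u₀ u₁ (ρ S w) w) ⟨
    ι x (ρ g (comb u₀ u₁ (ρ S w) w))
      ≡⟨ act-ι x g _ ⟨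
    act (value x) g (homOf x w (u₀ ∷ u₁ ∷ [])) ∎
    where open ≡-Reasoning

InSt-always : ∀ u → InSt u
InSt-always u fzero        ()
InSt-always u (fsuc fzero) ()

polyX polyY : Poly 1
polyX = false ∷ true ∷ []
polyY = true ∷ false ∷ []

Poly₁-decompose : ∀ u₀ u₁ → (u₀ ∷ u₁ ∷ []) ≡ (u₀ ·P polyY) +P (u₁ ·P polyX)
Poly₁-decompose true  true  = refl
Poly₁-decompose true  false = refl
Poly₁-decompose false true  = refl
Poly₁-decompose false false = refl

InW-intro : ∀ {s} {w : Tensor s} → ρ T w ≡ w → (w +ᵀ ρ S w) +ᵀ ρ R w ≡ 0ᵀ → InW w
InW-intro {w = w} Tw≡w sum≡0 =
    trans (⟦⟧-∷ I [ T ] w) (trans (cong₂ _+ᵀ_ (ρ-I w) (trans (⟦[ T ]⟧ w) Tw≡w)) (+ᵀ-self w))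
  ∷ trans (⟦⟧-∷ I (S ∷ R ∷ []) w)
          (trans (cong₂ _+ᵀ_ (ρ-I w) (trans (⟦⟧-∷ S [ R ] w) (cong (ρ S w +ᵀ_) (⟦[ R ]⟧ w))))
                 (trans (sym (+ᵀ-assoc w (ρ S w) (ρ R w))) sum≡0))
  ∷ []

-- A G-map f is determined by w = f(X): f(Y) = f(S X) = S w, and T X = X and
-- X + Y + R X = 0 put w in W.
homOf-onto : ∀ x f → IsGHom (value x) f → Σ (Tensor (weight x)) (λ w → InW w × f ≈M homOf x w)
homOf-onto x f (f∈L , f-additive , f-homogeneous , f-equivariant) =
  w , InW-intro Tw≡w (ι-injective x sum≡0) , f≈homOf
  where
  f-+ : ∀ u v → f (u +P v) ≡ f u +P f v
  f-+ u v = f-additive u v (InSt-always u) (InSt-always v)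
  f-· : ∀ β u → f (β ·P u) ≡ β ·P f u
  f-· β u = f-homogeneous β u (InSt-always u)
  w : Tensor (weight x)
  w = read x (f polyX)
  ιw : ι x w ≡ f polyX
  ιw = ι-read x (f polyX) (f∈L polyX (InSt-always polyX))
  ι-ρ : ∀ g → InSL2 g → ι x (ρ g w) ≡ f (act 1 g polyX)
  ι-ρ g g∈SL₂ =
    trans (sym (act-ι x g w)) (trans (cong (act (value x) g) ιw) (sym (f-equivariant g g∈SL₂ polyX (InSt-always polyX))))
  ιSw : ι x (ρ S w) ≡ f polyY
  ιSw = ι-ρ S refl
  Tw≡w : ρ T w ≡ w
  Tw≡w = ι-injective x (trans (ι-ρ T refl) (sym ιw))
  sum≡0 : ι x ((w +ᵀ ρ S w) +ᵀ ρ R w) ≡ ι x 0ᵀ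
  sum≡0 = begin
    ι x ((w +ᵀ ρ S w) +ᵀ ρ R w)                     ≡⟨ trans (ι-+ᵀ x _ _) (cong (_+P ι x (ρ R w)) (ι-+ᵀ x w (ρ S w))) ⟩
    (ι x w +P ι x (ρ S w)) +P ι x (ρ R w)           ≡⟨ cong₂ _+P_ (cong₂ _+P_ ιw ιSw) (ι-ρ R refl) ⟩
    (f polyX +P f polyY) +P f (polyX +P polyY)      ≡⟨ cong ((f polyX +P f polyY) +P_) (f-+ polyX polyY) ⟩
    (f polyX +P f polyY) +P (f polyX +P f polyY)    ≡⟨ zipWith-self (f polyX +P f polyY) ⟩
    0P                                              ≡⟨ ι-0ᵀ x ⟨
    ι x 0ᵀ                                          ∎
    where open ≡-Reasoning
  f≈homOf : f ≈M homOf x w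
  f≈homOf (u₀ ∷ u₁ ∷ []) _ = begin
    f (u₀ ∷ u₁ ∷ [])                               ≡⟨ cong f (Poly₁-decompose u₀ u₁) ⟩
    f ((u₀ ·P polyY) +P (u₁ ·P polyX))             ≡⟨ f-+ (u₀ ·P polyY) (u₁ ·P polyX) ⟩
    f (u₀ ·P polyY) +P f (u₁ ·P polyX)             ≡⟨ cong₂ _+P_ (f-· u₀ polyY) (f-· u₁ polyX) ⟩
    (u₀ ·P f polyY) +P (u₁ ·P f polyX)             ≡⟨ cong₂ _+P_ (cong (u₀ ·P_) ιSw) (cong (u₁ ·P_) ιw) ⟨
    (u₀ ·P ι x (ρ S w)) +P (u₁ ·P ι x w)           ≡⟨ cong₂ _+P_ (ι-·ᵀ x u₀ (ρ S w)) (ι-·ᵀ x u₁ w) ⟨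
    ι x (u₀ ·ᵀ ρ S w) +P ι x (u₁ ·ᵀ w)             ≡⟨ ι-+ᵀ x _ _ ⟨
    ι x (u₀ ·ᵀ ρ S w +ᵀ u₁ ·ᵀ w)                   ≡⟨ cong (ι x) (comb-lin u₀ u₁ (ρ S w) w) ⟨
    homOf x w (u₀ ∷ u₁ ∷ [])                       ∎
    where open ≡-Reasoning

dimHom-binary : ∀ x → DimHom (value x) (dimW (weight x))
dimHom-binary x = hasDim-Map (IsGHom (value x)) (λ c → homOf x (embed c)) lin
                             (λ c → homOf-isGHom x (embed-∈ c)) injective onto
  where
  open Coordinates (coordinatesW (weight x))
  lin : ∀ u → Linear (λ c → homOf x (embed c) u)
  lin (u₀ ∷ u₁ ∷ []) c c′ = begin
    ι x (comb u₀ u₁ (ρ S (embed (zipWith _xor_ c c′))) (embed (zipWith _xor_ c c′)))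
      ≡⟨ cong (λ v → ι x (comb u₀ u₁ (ρ S v) v)) (embed-xor c c′) ⟩
    ι x (comb u₀ u₁ (ρ S (embed c +ᵀ embed c′)) (embed c +ᵀ embed c′))
      ≡⟨ cong (λ v → ι x (comb u₀ u₁ v (embed c +ᵀ embed c′))) (ρ-+ᵀ S (embed c) (embed c′)) ⟩
    ι x (comb u₀ u₁ (ρ S (embed c) +ᵀ ρ S (embed c′)) (embed c +ᵀ embed c′))
      ≡⟨ cong (ι x) (comb-+ᵀ u₀ u₁ _ _ _ _) ⟩
    ι x (comb u₀ u₁ (ρ S (embed c)) (embed c) +ᵀ comb u₀ u₁ (ρ S (embed c′)) (embed c′))
      ≡⟨ ι-+ᵀ x _ _ ⟩
    homOf x (embed c) (u₀ ∷ u₁ ∷ []) +P homOf x (embed c′) (u₀ ∷ u₁ ∷ []) ∎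
    where open ≡-Reasoning
  injective : ∀ c → homOf x (embed c) ≈M 0M → c ≡ replicate _ false
  injective c hom≈0 = embed-injective (coordinatesW (weight x)) c
    (ι-injective x (trans (hom≈0 polyX (InSt-always polyX)) (sym (ι-0ᵀ x))))
  onto : ∀ f → IsGHom (value x) f → Σ (Vec Bool _) (λ c → f ≈M homOf x (embed c))
  onto f f-hom with homOf-onto x f f-hom
  ... | w , w∈W , f≈homOf =
    coords w , λ u u∈st → trans (f≈homOf u u∈st) (cong (λ v → homOf x v u) (sym (embed-coords w∈W)))

dimTensor≡ : ∀ s → dimTensor s ≡ (dimW s + dimW s) + dimM s
dimTensor≡ zero    = refl
dimTensor≡ (suc s) = begin
  dimTensor s + dimTensor s                              ≡⟨ cong₂ _+_ (dimTensor≡ s) (dimTensor≡ s) ⟩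
  ((w + w) + m) + ((w + w) + m)                          ≡⟨ regroup w m ⟩
  ((m + w) + (m + w)) + (w + w)                          ∎
  where
  open ≡-Reasoning
  w m : ℕ
  w = dimW s
  m = dimM s
  regroup : ∀ w m → ((w + w) + m) + ((w + w) + m) ≡ ((m + w) + (m + w)) + (w + w)
  regroup = solve-∀

dimM-dimW : ∀ s → (dimM s ≡ suc (dimW s)) ⊎ (dimW s ≡ suc (dimM s))
dimM-dimW zero = inj₁ refl
dimM-dimW (suc s) with dimM-dimW s
... | inj₁ m≡1+w = inj₂ (cong (_+ dimW s) m≡1+w)
... | inj₂ w≡1+m = inj₁ (trans (cong (λ w → w + w) w≡1+m) (cong (λ w → suc (dimM s + w)) (sym w≡1+m)))

quotient-by-3 : ∀ r k → r < 3 → (r + k * 3) / 3 ≡ k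
quotient-by-3 r k r<3 = begin
  (r + k * 3) / 3         ≡⟨ +-distrib-/ r (k * 3) remainders<3 ⟩
  r / 3 + k * 3 / 3       ≡⟨ cong₂ _+_ (m<n⇒m/n≡0 r<3) (m*n/n≡m k 3) ⟩
  k                       ∎
  where
  open ≡-Reasoning
  remainders<3 : r % 3 + k * 3 % 3 < 3
  remainders<3 = subst (_< 3) (sym (trans (cong₂ _+_ (m<n⇒m%n≡m r<3) (m*n%n≡0 k 3)) (+-identityʳ r))) r<3

dimTensor-mod3 : ∀ s → ((dimTensor s % 3 ≡ 1) ⊎ (dimTensor s % 3 ≡ 2)) × ((dimTensor s + 1) / 3 ≡ dimW s)
dimTensor-mod3 s with dimM-dimW s | dimTensor≡ s
... | inj₁ m≡1+w | t≡ = inj₁ (trans (cong (_% 3) t≡1+3w) ([m+kn]%n≡m%n 1 w 3))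
                      , trans (cong (λ t → (t + 1) / 3) t≡1+3w)
                              (trans (cong (_/ 3) (shift w)) (quotient-by-3 2 w (s≤s (s≤s (s≤s z≤n)))))
  where
  w : ℕ
  w = dimW s
  t≡1+3w : dimTensor s ≡ 1 + w * 3
  t≡1+3w = trans t≡ (trans (cong ((w + w) +_) m≡1+w) (thrice w))
    where thrice : ∀ w → (w + w) + suc w ≡ 1 + w * 3
          thrice = solve-∀
  shift : ∀ w → (1 + w * 3) + 1 ≡ 2 + w * 3
  shift = solve-∀
... | inj₂ w≡1+m | t≡ = inj₂ (trans (cong (_% 3) t≡2+3m) ([m+kn]%n≡m%n 2 m 3))
                      , trans (cong (λ t → (t + 1) / 3) t≡2+3m)
                              (trans (cong (_/ 3) (shift m)) (trans (quotient-by-3 0 (suc m) (s≤s z≤n)) (sym w≡1+m)))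
  where
  m : ℕ
  m = dimM s
  t≡2+3m : dimTensor s ≡ 2 + m * 3
  t≡2+3m = trans t≡ (trans (cong (λ w → (w + w) + m) w≡1+m) (thrice m))
    where thrice : ∀ m → (suc m + suc m) + m ≡ 2 + m * 3
          thrice = solve-∀
  shift : ∀ m → (2 + m * 3) + 1 ≡ 0 + suc m * 3
  shift = solve-∀

proposition6p4 : (k : ℕ) → Σ ℕ (λ n → DimL k n × ((n % 3 ≡ 1) ⊎ (n % 3 ≡ 2)) × DimHom k ((n + 1) / 3))
proposition6p4 k = subst (λ k → Σ ℕ (λ n → DimL k n × ((n % 3 ≡ 1) ⊎ (n % 3 ≡ 2)) × DimHom k ((n + 1) / 3)))
                         (value-binary k) (for-binary (binary k))
  where
  for-binary : ∀ x → Σ ℕ (λ n → DimL (value x) n × ((n % 3 ≡ 1) ⊎ (n % 3 ≡ 2)) × DimHom (value x) ((n + 1) / 3))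
  for-binary x with dimTensor-mod3 (weight x)
  ... | residue , quotient =
    dimTensor (weight x) , dimL-binary x , residue , subst (DimHom (value x)) (sym quotient) (dimHom-binary x)
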